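{- Let $\mathcal{V}$ be a $\ast$-autonomous category whose monoidal unit $I$ is the dualizing object, and let $A$ be a pseudo-affine object of $\mathcal{V}$. If $([A,A],\circ)$ carries a Frobenius structure (i.e. there exist $B,\epsilon,l,r$ such that $([A,A],B,\epsilon,\circ,l,r)$ is a Frobenius structure), then $A$ is nuclear.
   Context: $\mathcal{V}$ is symmetric monoidal closed (strict), with unit $I$, unitors $\lambda,\rho$, symmetry $\sigma$, internal hom $[X,Z]$ right adjoint to $X\otimes -$, evaluation $ev_{X,Z}:X\otimes[X,Z]\to Z$; $X^*:=[X,I]$; $\ast$-autonomous means the canonical $j_X:X\to X^{**}$ (transpose of $ev_{X,I}\circ\sigma_{X^*,X}$) is always an isomorphism. Internal composition $\circ:[A,A]\otimes[A,A]\to[A,A]$ is the transpose of $ev_{A,A}\circ(ev_{A,A}\otimes[A,A])$. $\mathtt{mix}_{A,A}: A^*\otimes A\to[A,A]$ is the transpose of $\lambda_A\circ(ev_{A,I}\otimes A)$; $A$ is nuclear if $\mathtt{mix}_{A,A}$ is an isomorphism. $A$ is pseudo-affine if there are $p: I\to A$, $c: A\to I$ with $c\circ p=\mathrm{id}_I$. A dual pairing is $\epsilon: A\otimes B\to I$ such that for all $X$, $f\mapsto\epsilon\circ(A\otimes f)$ is a bijection $\hom(X,B)\to\hom(A\otimes X,I)$ and $g\mapsto\epsilon\circ(g\otimes B)$ is a bijection $\hom(X,A)\to\hom(X\otimes B,I)$. For a dual pairing and associative $\mu_A$, $\lhd:A\otimes B\to B$ is the unique map with $\epsilon\circ(A\otimes\lhd)=\epsilon\circ(\mu_A\otimes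 B)$ and $\rhd:B\otimes A\to B$ the unique map with $\epsilon\circ(A\otimes\rhd)=\epsilon\circ(\mu_A\otimes B)\circ\sigma_{A\otimes B,A}$. A Frobenius structure is $(A,B,\epsilon,\mu_A,l,r)$ with $\epsilon$ a dual pairing, $\mu_A$ associative, $l,r:A\to B$ isomorphisms with $\epsilon\circ(A\otimes r)=\epsilon\circ(A\otimes l)\circ\sigma_{A,A}$ and $\lhd\circ(A\otimes r)=\rhd\circ(l\otimes A)$. -}

module Defs where

open import Level using (Level; _⊔_) renaming (suc to lsuc)
open import Data.Product using (Σ; Σ-syntax; ∃; _×_; _,_)
open import Relation.Binary.PropositionalEquality using (_≡_)
open import Function.Definitions using (Bijective)

record SMCC (o ℓ : Level) : Set (lsuc (o ⊔ ℓ)) where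
  infixr 9 _∘_
  infixr 10 _⊗₀_ _⊗₁_
  field
    Obj : Set o
    _⇒_ : Obj → Obj → Set ℓ
    id  : ∀ {X} → X ⇒ X
    _∘_ : ∀ {X Y Z} → Y ⇒ Z → X ⇒ Y → X ⇒ Z
    identityˡ : ∀ {X Y} {f : X ⇒ Y} → id ∘ f ≡ f
    identityʳ : ∀ {X Y} {f : X ⇒ Y} → f ∘ id ≡ f
    assoc : ∀ {X Y Z W} {f : X ⇒ Y} {g : Y ⇒ Z} {h : Z ⇒ W} →
            (h ∘ g) ∘ f ≡ h ∘ (g ∘ f)

    I    : Obj
    _⊗₀_ : Obj → Obj → Obj
    _⊗₁_ : ∀ {X Y Z W} → X ⇒ Y → Z ⇒ W → (X ⊗₀ Z) ⇒ (Y ⊗₀ W)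
    ⊗-id : ∀ {X Y} → id {X} ⊗₁ id {Y} ≡ id
    ⊗-∘  : ∀ {X Y Z X' Y' Z'} {f : X ⇒ Y} {f' : Y ⇒ Z} {g : X' ⇒ Y'} {g' : Y' ⇒ Z'} →
           (f' ∘ f) ⊗₁ (g' ∘ g) ≡ (f' ⊗₁ g') ∘ (f ⊗₁ g)

    α    : ∀ {X Y Z} → ((X ⊗₀ Y) ⊗₀ Z) ⇒ (X ⊗₀ (Y ⊗₀ Z))
    α⁻¹  : ∀ {X Y Z} → (X ⊗₀ (Y ⊗₀ Z)) ⇒ ((X ⊗₀ Y) ⊗₀ Z)
    α-isoˡ : ∀ {X Y Z} → α⁻¹ {X} {Y} {Z} ∘ α ≡ id
    α-isoʳ : ∀ {X Y Z} → α {X} {Y} {Z} ∘ α⁻¹ ≡ id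
    α-natural : ∀ {X Y Z X' Y' Z'} {f : X ⇒ X'} {g : Y ⇒ Y'} {h : Z ⇒ Z'} →
                α ∘ ((f ⊗₁ g) ⊗₁ h) ≡ (f ⊗₁ (g ⊗₁ h)) ∘ α

    unitorˡ    : ∀ {X} → (I ⊗₀ X) ⇒ X
    unitorˡ⁻¹  : ∀ {X} → X ⇒ (I ⊗₀ X)
    unitorˡ-isoˡ : ∀ {X} → unitorˡ⁻¹ {X} ∘ unitorˡ ≡ id
    unitorˡ-isoʳ : ∀ {X} → unitorˡ {X} ∘ unitorˡ⁻¹ ≡ id
    unitorˡ-natural : ∀ {X Y} {f : X ⇒ Y} → unitorˡ ∘ (id ⊗₁ f) ≡ f ∘ unitorˡ

    unitorʳ    : ∀ {X} → (X ⊗₀ I) ⇒ X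
    unitorʳ⁻¹  : ∀ {X} → X ⇒ (X ⊗₀ I)
    unitorʳ-isoˡ : ∀ {X} → unitorʳ⁻¹ {X} ∘ unitorʳ ≡ id
    unitorʳ-isoʳ : ∀ {X} → unitorʳ {X} ∘ unitorʳ⁻¹ ≡ id
    unitorʳ-natural : ∀ {X Y} {f : X ⇒ Y} → unitorʳ ∘ (f ⊗₁ id) ≡ f ∘ unitorʳ

    σ : ∀ {X Y} → (X ⊗₀ Y) ⇒ (Y ⊗₀ X)
    σ-natural : ∀ {X Y X' Y'} {f : X ⇒ X'} {g : Y ⇒ Y'} →
                σ ∘ (f ⊗₁ g) ≡ (g ⊗₁ f) ∘ σ
    σ-involutive : ∀ {X Y} → σ {Y} {X} ∘ σ {X} {Y} ≡ id

    pentagon : ∀ {W X Y Z} →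
      (id {W} ⊗₁ α {X} {Y} {Z}) ∘ α {W} {X ⊗₀ Y} {Z} ∘ (α {W} {X} {Y} ⊗₁ id {Z})
        ≡ α {W} {X} {Y ⊗₀ Z} ∘ α {W ⊗₀ X} {Y} {Z}
    triangle : ∀ {X Y} →
      (id {X} ⊗₁ unitorˡ {Y}) ∘ α {X} {I} {Y} ≡ unitorʳ {X} ⊗₁ id {Y}
    hexagon : ∀ {X Y Z} →
      α {Y} {Z} {X} ∘ σ {X} {Y ⊗₀ Z} ∘ α {X} {Y} {Z}
        ≡ (id {Y} ⊗₁ σ {X} {Z}) ∘ α {Y} {X} {Z} ∘ (σ {X} {Y} ⊗₁ id {Z})

    -- closed structure: X ⊗ - ⊣ [X , -]
    [_,_] : Obj → Obj → Obj
    ev    : ∀ {X Z} → (X ⊗₀ [ X , Z ]) ⇒ Z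
    curry : ∀ {X Y Z} → (X ⊗₀ Y) ⇒ Z → Y ⇒ [ X , Z ]
    ev-curry : ∀ {X Y Z} {f : (X ⊗₀ Y) ⇒ Z} → ev ∘ (id ⊗₁ curry f) ≡ f
    curry-unique : ∀ {X Y Z} {g : Y ⇒ [ X , Z ]} → curry (ev ∘ (id ⊗₁ g)) ≡ g

module _ {o ℓ : Level} (V : SMCC o ℓ) where
  open SMCC V

  IsIso : ∀ {X Y} → X ⇒ Y → Set ℓ
  IsIso {X} {Y} f = Σ[ g ∈ Y ⇒ X ] ((g ∘ f ≡ id) × (f ∘ g ≡ id))

  _* : Obj → Obj
  X * = [ X , I ]

  jmap : (X : Obj) → X ⇒ ((X *) *)
  jmap X = curry {X *} {X} {I} (ev {X} {I} ∘ σ {X *} {X})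

  StarAutonomous : Set (o ⊔ ℓ)
  StarAutonomous = ∀ X → IsIso (jmap X)

  icomp : (A : Obj) → ([ A , A ] ⊗₀ [ A , A ]) ⇒ [ A , A ]
  icomp A = curry (ev {A} {A} ∘ (ev {A} {A} ⊗₁ id {[ A , A ]})
                   ∘ α⁻¹ {A} {[ A , A ]} {[ A , A ]})

  mix : (A : Obj) → ((A *) ⊗₀ A) ⇒ [ A , A ]
  mix A = curry (unitorˡ {A} ∘ (ev {A} {I} ⊗₁ id {A}) ∘ α⁻¹ {A} {A *} {A})

  Nuclear : Obj → Set ℓ
  Nuclear A = IsIso (mix A)

  PseudoAffine : Obj → Set ℓ
  PseudoAffine A = Σ[ p ∈ I ⇒ A ] Σ[ c ∈ A ⇒ I ] (c ∘ p ≡ id)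

  DualPairing : (A B : Obj) → (A ⊗₀ B) ⇒ I → Set (o ⊔ ℓ)
  DualPairing A B ε =
    (∀ X → Bijective _≡_ _≡_ (λ (f : X ⇒ B) → ε ∘ (id {A} ⊗₁ f)))
    × (∀ X → Bijective _≡_ _≡_ (λ (g : X ⇒ A) → ε ∘ (g ⊗₁ id {B})))

  Associative : (A : Obj) → (A ⊗₀ A) ⇒ A → Set ℓ
  Associative A μ = μ ∘ (μ ⊗₁ id {A}) ≡ μ ∘ (id {A} ⊗₁ μ) ∘ α {A} {A} {A}

  IsLeftAct : (A B : Obj) → (A ⊗₀ B) ⇒ I → (A ⊗₀ A) ⇒ A → (A ⊗₀ B) ⇒ B → Set ℓ
  IsLeftAct A B ε μ ◁ =
    ε ∘ (id {A} ⊗₁ ◁) ≡ ε ∘ (μ ⊗₁ id {B}) ∘ α⁻¹ {A} {A} {B}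

  IsRightAct : (A B : Obj) → (A ⊗₀ B) ⇒ I → (A ⊗₀ A) ⇒ A → (B ⊗₀ A) ⇒ B → Set ℓ
  IsRightAct A B ε μ ▷ =
    ε ∘ (id {A} ⊗₁ ▷)
      ≡ ε ∘ (μ ⊗₁ id {B}) ∘ α⁻¹ {A} {A} {B} ∘ σ {A ⊗₀ B} {A} ∘ α⁻¹ {A} {B} {A}

  -- (A, B, ε, μ, l, r) is a Frobenius structure.  ◁ and ▷ are determined
  -- uniquely by the dual pairing; they are recorded with their
  -- defining equations.
  record IsFrobenius (A B : Obj) (ε : (A ⊗₀ B) ⇒ I) (μ : (A ⊗₀ A) ⇒ A)
                     (l r : A ⇒ B) : Set (o ⊔ ℓ) where
    field
      dual  : DualPairing A B ε
      μ-assoc : Associative A μ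
      l-iso : IsIso l
      r-iso : IsIso r
      ◁ : (A ⊗₀ B) ⇒ B
      ▷ : (B ⊗₀ A) ⇒ B
      ◁-def : IsLeftAct A B ε μ ◁
      ▷-def : IsRightAct A B ε μ ▷
      ε-lr  : ε ∘ (id {A} ⊗₁ r) ≡ ε ∘ (id {A} ⊗₁ l) ∘ σ {A} {A}
      act-lr : ◁ ∘ (id {A} ⊗₁ r) ≡ ▷ ∘ (l ⊗₁ id {A})

  HasFrobenius : (A : Obj) → (A ⊗₀ A) ⇒ A → Set (o ⊔ ℓ)
  HasFrobenius A μ =
    Σ[ B ∈ Obj ] Σ[ ε ∈ (A ⊗₀ B) ⇒ I ] Σ[ l ∈ A ⇒ B ] Σ[ r ∈ A ⇒ B ]
      IsFrobenius A B ε μ l r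

-- The Frobenius structure makes β := ε ∘ (id ⊗ r) a cyclic pairing on [A,A]: β(f;g, h) = β(g, h;f),
-- where f;g := μ(f ⊗ g) = g ∘ f.  Transposing (f, φ) ↦ φ(f p) through β, and then through A ≅ A**,
-- yields v : A → A such that trace(f) := β(f, ⌜v⌝) satisfies trace ∘ mix = ev ∘ σ; here
-- pseudo-affinity enters through mix(φ ⊗ a) = (p ∘ φ) ; (x ↦ c(x) a), which lets cyclicity move
-- ⌜v⌝ next to p ∘ φ.  Pulled back along mix, (f, g) ↦ trace(f;g) is the canonical symmetric pairing
-- Φ on D = A* ⊗ A, and its transpose Ψ : D → D* satisfies Λ ∘ Ψ = mix for the canonical
-- Λ : D* → [A,A].  Transposing (ξ, f) ↦ trace(f ; Λ ξ) through D ≅ D** then gives a two-sided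
-- inverse of mix.
module Submission where

open import Level using (Level)
open import Data.Product using (_,_; proj₁; proj₂)
open import Relation.Binary.PropositionalEquality
  using (_≡_; refl; sym; trans; cong; cong₂; module ≡-Reasoning)
open import Defs

module _ {o ℓ : Level} (V : SMCC o ℓ) where
  open SMCC V
  open ≡-Reasoning

  module MonoidalReasoning where
    infixr 4 _⟩⊗⟨_
    infixr 5 refl⟩∘⟨_
    infixl 5 _⟩∘⟨refl

    _⟩⊗⟨_ : ∀ {X Y Z W} {f f' : X ⇒ Y} {g g' : Z ⇒ W} → f ≡ f' → g ≡ g' → f ⊗₁ g ≡ f' ⊗₁ g'
    p ⟩⊗⟨ q = cong₂ _⊗₁_ p q

    refl⟩∘⟨_ : ∀ {X Y Z} {f : Y ⇒ Z} {g g' : X ⇒ Y} → g ≡ g' → f ∘ g ≡ f ∘ g'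
    refl⟩∘⟨_ {f = f} p = cong (f ∘_) p

    _⟩∘⟨refl : ∀ {X Y Z} {f f' : Y ⇒ Z} {g : X ⇒ Y} → f ≡ f' → f ∘ g ≡ f' ∘ g
    _⟩∘⟨refl {g = g} p = cong (_∘ g) p

    pullˡ : ∀ {W X Y Z} {a : Y ⇒ Z} {b : X ⇒ Y} {c : X ⇒ Z} {f : W ⇒ X} →
      a ∘ b ≡ c → a ∘ b ∘ f ≡ c ∘ f
    pullˡ {f = f} p = trans (sym assoc) (cong (_∘ f) p)

    cancelˡ : ∀ {X Y Z} {a : Y ⇒ X} {b : X ⇒ Y} {f : Z ⇒ X} → a ∘ b ≡ id → a ∘ b ∘ f ≡ f
    cancelˡ p = trans (pullˡ p) identityˡ

    insertˡ : ∀ {X Y Z} {a : Y ⇒ X} {b : X ⇒ Y} {f : Z ⇒ X} → a ∘ b ≡ id → f ≡ a ∘ b ∘ f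
    insertˡ p = sym (cancelˡ p)

    cancelʳ : ∀ {X Y Z} {a : Y ⇒ X} {b : X ⇒ Y} {f : X ⇒ Z} → a ∘ b ≡ id → (f ∘ a) ∘ b ≡ f
    cancelʳ p = trans assoc (trans (cong (_ ∘_) p) identityʳ)

    serialize₁₂ : ∀ {X Y Z W} {f : X ⇒ Y} {g : Z ⇒ W} → f ⊗₁ g ≡ (f ⊗₁ id) ∘ (id ⊗₁ g)
    serialize₁₂ = trans (sym identityʳ ⟩⊗⟨ sym identityˡ) ⊗-∘

    serialize₂₁ : ∀ {X Y Z W} {f : X ⇒ Y} {g : Z ⇒ W} → f ⊗₁ g ≡ (id ⊗₁ g) ∘ (f ⊗₁ id)
    serialize₂₁ = trans (sym identityˡ ⟩⊗⟨ sym identityʳ) ⊗-∘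

    ⊗id-id⊗-commute : ∀ {X Y Z W} {f : X ⇒ Y} {g : Z ⇒ W} → (f ⊗₁ id) ∘ (id ⊗₁ g) ≡ (id ⊗₁ g) ∘ (f ⊗₁ id)
    ⊗id-id⊗-commute = trans (sym serialize₁₂) serialize₂₁

    split₁ˡ : ∀ {X Y Z W} {f : Y ⇒ Z} {g : X ⇒ Y} → (f ∘ g) ⊗₁ id {W} ≡ (f ⊗₁ id) ∘ (g ⊗₁ id)
    split₁ˡ = trans (refl ⟩⊗⟨ sym identityˡ) ⊗-∘

    split₁ʳ : ∀ {X Y Z W V'} {f : Y ⇒ Z} {g : X ⇒ Y} {h : W ⇒ V'} → (f ∘ g) ⊗₁ h ≡ (f ⊗₁ h) ∘ (g ⊗₁ id)
    split₁ʳ = trans (refl ⟩⊗⟨ sym identityʳ) ⊗-∘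

    split₂ˡ : ∀ {X Y Z W} {f : Y ⇒ Z} {g : X ⇒ Y} → id {W} ⊗₁ (f ∘ g) ≡ (id ⊗₁ f) ∘ (id ⊗₁ g)
    split₂ˡ = trans (sym identityˡ ⟩⊗⟨ refl) ⊗-∘

    split₂ʳ : ∀ {X Y Z W V'} {f : Y ⇒ Z} {g : X ⇒ Y} {h : W ⇒ V'} → h ⊗₁ (f ∘ g) ≡ (h ⊗₁ f) ∘ (id ⊗₁ g)
    split₂ʳ = trans (sym identityʳ ⟩⊗⟨ refl) ⊗-∘

    merge₁ : ∀ {X Y Z W U} {f : Y ⇒ Z} {g : X ⇒ Y} {h : W ⇒ U} → (f ⊗₁ id) ∘ (g ⊗₁ h) ≡ (f ∘ g) ⊗₁ h
    merge₁ = trans (sym ⊗-∘) (refl ⟩⊗⟨ identityˡ)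

    merge₂ : ∀ {X Y Z W U} {g : Z ⇒ W} {f : X ⇒ Y} {h : U ⇒ Z} → (id ⊗₁ g) ∘ (f ⊗₁ h) ≡ f ⊗₁ (g ∘ h)
    merge₂ = trans (sym ⊗-∘) (identityˡ ⟩⊗⟨ refl)

    ⊗id-inverse : ∀ {X Y Z} {f : X ⇒ Y} {f⁻ : Y ⇒ X} → f ∘ f⁻ ≡ id → (f ⊗₁ id {Z}) ∘ (f⁻ ⊗₁ id) ≡ id
    ⊗id-inverse p = trans (sym split₁ˡ) (trans (p ⟩⊗⟨ refl) ⊗-id)

    id⊗-inverse : ∀ {X Y Z} {f : X ⇒ Y} {f⁻ : Y ⇒ X} → f ∘ f⁻ ≡ id → (id {Z} ⊗₁ f) ∘ (id ⊗₁ f⁻) ≡ id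
    id⊗-inverse p = trans (sym split₂ˡ) (trans (refl ⟩⊗⟨ p) ⊗-id)

    inverse-natural : ∀ {X Y X' Y'} {i : X ⇒ Y} {i⁻ : Y ⇒ X} {k : X' ⇒ Y'} {k⁻ : Y' ⇒ X'}
      {f : X ⇒ X'} {g : Y ⇒ Y'} →
      i ∘ i⁻ ≡ id → k⁻ ∘ k ≡ id → k ∘ f ≡ g ∘ i → k⁻ ∘ g ≡ f ∘ i⁻
    inverse-natural {i = i} {i⁻} {k} {k⁻} {f} {g} ii kk nat = begin
      k⁻ ∘ g                 ≡⟨ refl⟩∘⟨ sym (trans (refl⟩∘⟨ ii) identityʳ) ⟩
      k⁻ ∘ g ∘ i ∘ i⁻        ≡⟨ refl⟩∘⟨ sym assoc ⟩
      k⁻ ∘ (g ∘ i) ∘ i⁻      ≡⟨ refl⟩∘⟨ (sym nat ⟩∘⟨refl) ⟩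
      k⁻ ∘ (k ∘ f) ∘ i⁻      ≡⟨ refl⟩∘⟨ assoc ⟩
      k⁻ ∘ k ∘ f ∘ i⁻        ≡⟨ cancelˡ kk ⟩
      f ∘ i⁻ ∎

    split-mono-cancel : ∀ {X Y Z} {i : Y ⇒ Z} {i⁻ : Z ⇒ Y} {f g : X ⇒ Y} → i⁻ ∘ i ≡ id → i ∘ f ≡ i ∘ g → f ≡ g
    split-mono-cancel {i = i} {i⁻} {f} {g} ii p = begin
      f ≡⟨ insertˡ ii ⟩ i⁻ ∘ i ∘ f ≡⟨ refl⟩∘⟨ p ⟩ i⁻ ∘ i ∘ g ≡⟨ cancelˡ ii ⟩ g ∎

    split-epi-cancel : ∀ {X Y Z} {i : X ⇒ Y} {i⁻ : Y ⇒ X} {f g : Y ⇒ Z} → i ∘ i⁻ ≡ id → f ∘ i ≡ g ∘ i → f ≡ g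
    split-epi-cancel {i = i} {i⁻} {f} {g} ii p = begin
      f ≡⟨ sym (cancelʳ ii) ⟩ (f ∘ i) ∘ i⁻ ≡⟨ p ⟩∘⟨refl ⟩ (g ∘ i) ∘ i⁻ ≡⟨ cancelʳ ii ⟩ g ∎

    inverse-∘ : ∀ {X Y Z} {a : Y ⇒ Z} {a⁻ : Z ⇒ Y} {b : X ⇒ Y} {b⁻ : Y ⇒ X} {c : X ⇒ Z} {c⁻ : Z ⇒ X} →
      a ∘ a⁻ ≡ id → b ∘ b⁻ ≡ id → c⁻ ∘ c ≡ id → a ∘ b ≡ c → b⁻ ∘ a⁻ ≡ c⁻
    inverse-∘ {a = a} {a⁻} {b} {b⁻} {c} {c⁻} aa bb cc abc = begin
      b⁻ ∘ a⁻ ≡⟨ insertˡ cc ⟩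
      c⁻ ∘ c ∘ b⁻ ∘ a⁻ ≡⟨ refl⟩∘⟨ (sym abc ⟩∘⟨refl) ⟩
      c⁻ ∘ (a ∘ b) ∘ b⁻ ∘ a⁻ ≡⟨ refl⟩∘⟨ trans assoc (refl⟩∘⟨ cancelˡ bb) ⟩
      c⁻ ∘ a ∘ a⁻ ≡⟨ refl⟩∘⟨ aa ⟩
      c⁻ ∘ id ≡⟨ identityʳ ⟩
      c⁻ ∎

    α⁻¹-natural : ∀ {X Y Z X' Y' Z'} {f : X ⇒ X'} {g : Y ⇒ Y'} {h : Z ⇒ Z'} →
      α⁻¹ ∘ (f ⊗₁ (g ⊗₁ h)) ≡ ((f ⊗₁ g) ⊗₁ h) ∘ α⁻¹
    α⁻¹-natural = inverse-natural α-isoʳ α-isoˡ α-natural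

    α-natural₁ : ∀ {X X' Y Z} {f : X ⇒ X'} → α {X'} {Y} {Z} ∘ ((f ⊗₁ id) ⊗₁ id) ≡ (f ⊗₁ id) ∘ α
    α-natural₁ = trans α-natural ((refl ⟩⊗⟨ ⊗-id) ⟩∘⟨refl)

    α-natural₃ : ∀ {X Y Z Z'} {k : Z ⇒ Z'} → α {X} {Y} ∘ (id ⊗₁ k) ≡ (id ⊗₁ (id ⊗₁ k)) ∘ α
    α-natural₃ = trans (refl⟩∘⟨ (sym ⊗-id ⟩⊗⟨ refl)) α-natural

    α⁻¹-natural₃ : ∀ {X Y Z Z'} {k : Z ⇒ Z'} → α⁻¹ {X} {Y} ∘ (id ⊗₁ (id ⊗₁ k)) ≡ (id ⊗₁ k) ∘ α⁻¹
    α⁻¹-natural₃ = trans α⁻¹-natural ((⊗-id ⟩⊗⟨ refl) ⟩∘⟨refl)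

    unitorˡ⁻¹-natural : ∀ {X Y} {f : X ⇒ Y} → unitorˡ⁻¹ ∘ f ≡ (id ⊗₁ f) ∘ unitorˡ⁻¹
    unitorˡ⁻¹-natural = inverse-natural unitorˡ-isoʳ unitorˡ-isoˡ unitorˡ-natural

    unitorʳ⁻¹-natural : ∀ {X Y} {f : X ⇒ Y} → unitorʳ⁻¹ ∘ f ≡ (f ⊗₁ id) ∘ unitorʳ⁻¹
    unitorʳ⁻¹-natural = inverse-natural unitorʳ-isoʳ unitorʳ-isoˡ unitorʳ-natural

    I⊗-injective : ∀ {X Y} {f g : X ⇒ Y} → id {I} ⊗₁ f ≡ id ⊗₁ g → f ≡ g
    I⊗-injective {f = f} {g} p = split-epi-cancel unitorˡ-isoʳ (begin
      f ∘ unitorˡ ≡⟨ sym unitorˡ-natural ⟩ unitorˡ ∘ (id ⊗₁ f) ≡⟨ refl⟩∘⟨ p ⟩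
      unitorˡ ∘ (id ⊗₁ g) ≡⟨ unitorˡ-natural ⟩ g ∘ unitorˡ ∎)

    ⊗I-injective : ∀ {X Y} {f g : X ⇒ Y} → f ⊗₁ id {I} ≡ g ⊗₁ id → f ≡ g
    ⊗I-injective {f = f} {g} p = split-epi-cancel unitorʳ-isoʳ (begin
      f ∘ unitorʳ ≡⟨ sym unitorʳ-natural ⟩ unitorʳ ∘ (f ⊗₁ id) ≡⟨ refl⟩∘⟨ p ⟩
      unitorʳ ∘ (g ⊗₁ id) ≡⟨ unitorʳ-natural ⟩ g ∘ unitorʳ ∎)

    unitorˡ-coherence : ∀ {X Y} → unitorˡ {X ⊗₀ Y} ∘ α {I} {X} {Y} ≡ unitorˡ {X} ⊗₁ id {Y}
    unitorˡ-coherence {X} {Y} = I⊗-injective (split-epi-cancel α-α⊗id-inverse (begin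
        (id ⊗₁ (unitorˡ ∘ α)) ∘ α ∘ (α ⊗₁ id)
          ≡⟨ split₂ˡ ⟩∘⟨refl ⟩
        ((id ⊗₁ unitorˡ) ∘ (id ⊗₁ α)) ∘ α ∘ (α ⊗₁ id)
          ≡⟨ assoc ⟩
        (id ⊗₁ unitorˡ) ∘ (id ⊗₁ α) ∘ α ∘ (α ⊗₁ id)
          ≡⟨ refl⟩∘⟨ pentagon ⟩
        (id ⊗₁ unitorˡ) ∘ α ∘ α
          ≡⟨ pullˡ triangle ⟩
        (unitorʳ ⊗₁ id) ∘ α
          ≡⟨ sym α-natural₁ ⟩
        α ∘ ((unitorʳ ⊗₁ id) ⊗₁ id)
          ≡⟨ refl⟩∘⟨ sym (triangle ⟩⊗⟨ refl) ⟩
        α ∘ (((id ⊗₁ unitorˡ) ∘ α) ⊗₁ id)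
          ≡⟨ refl⟩∘⟨ split₁ˡ ⟩
        α ∘ ((id ⊗₁ unitorˡ) ⊗₁ id) ∘ (α ⊗₁ id)
          ≡⟨ sym assoc ⟩
        (α ∘ ((id ⊗₁ unitorˡ) ⊗₁ id)) ∘ (α ⊗₁ id)
          ≡⟨ α-natural ⟩∘⟨refl ⟩
        ((id ⊗₁ (unitorˡ ⊗₁ id)) ∘ α) ∘ (α ⊗₁ id)
          ≡⟨ assoc ⟩
        (id ⊗₁ (unitorˡ ⊗₁ id)) ∘ α ∘ (α ⊗₁ id) ∎))
      where
      α-α⊗id-inverse : (α {I} {I ⊗₀ X} {Y} ∘ (α {I} {I} {X} ⊗₁ id)) ∘ ((α⁻¹ ⊗₁ id) ∘ α⁻¹) ≡ id
      α-α⊗id-inverse = begin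
        (α ∘ (α ⊗₁ id)) ∘ ((α⁻¹ ⊗₁ id) ∘ α⁻¹) ≡⟨ assoc ⟩
        α ∘ (α ⊗₁ id) ∘ (α⁻¹ ⊗₁ id) ∘ α⁻¹ ≡⟨ refl⟩∘⟨ pullˡ (trans (sym split₁ˡ) (α-isoʳ ⟩⊗⟨ refl)) ⟩
        α ∘ (id ⊗₁ id) ∘ α⁻¹ ≡⟨ refl⟩∘⟨ trans (⊗-id ⟩∘⟨refl) identityˡ ⟩
        α ∘ α⁻¹ ≡⟨ α-isoʳ ⟩
        id ∎

    unitorʳ-coherence : ∀ {X Y} → (id {X} ⊗₁ unitorʳ {Y}) ∘ α {X} {Y} {I} ≡ unitorʳ {X ⊗₀ Y}
    unitorʳ-coherence {X} {Y} = ⊗I-injective (split-mono-cancel α-isoˡ (begin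
        α ∘ (((id ⊗₁ unitorʳ) ∘ α) ⊗₁ id)
          ≡⟨ refl⟩∘⟨ split₁ˡ ⟩
        α ∘ ((id ⊗₁ unitorʳ) ⊗₁ id) ∘ (α ⊗₁ id)
          ≡⟨ sym assoc ⟩
        (α ∘ ((id ⊗₁ unitorʳ) ⊗₁ id)) ∘ (α ⊗₁ id)
          ≡⟨ α-natural ⟩∘⟨refl ⟩
        ((id ⊗₁ (unitorʳ ⊗₁ id)) ∘ α) ∘ (α ⊗₁ id)
          ≡⟨ ((refl ⟩⊗⟨ sym triangle) ⟩∘⟨refl) ⟩∘⟨refl ⟩
        ((id ⊗₁ ((id ⊗₁ unitorˡ) ∘ α)) ∘ α) ∘ (α ⊗₁ id)
          ≡⟨ (split₂ˡ ⟩∘⟨refl) ⟩∘⟨refl ⟩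
        (((id ⊗₁ (id ⊗₁ unitorˡ)) ∘ (id ⊗₁ α)) ∘ α) ∘ (α ⊗₁ id)
          ≡⟨ trans assoc assoc ⟩
        (id ⊗₁ (id ⊗₁ unitorˡ)) ∘ (id ⊗₁ α) ∘ α ∘ (α ⊗₁ id)
          ≡⟨ refl⟩∘⟨ pentagon ⟩
        (id ⊗₁ (id ⊗₁ unitorˡ)) ∘ α ∘ α
          ≡⟨ sym assoc ⟩
        ((id ⊗₁ (id ⊗₁ unitorˡ)) ∘ α) ∘ α
          ≡⟨ sym (trans (refl⟩∘⟨ (sym ⊗-id ⟩⊗⟨ refl)) α-natural) ⟩∘⟨refl ⟩
        (α ∘ (id ⊗₁ unitorˡ)) ∘ α
          ≡⟨ assoc ⟩
        α ∘ (id ⊗₁ unitorˡ) ∘ α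
          ≡⟨ refl⟩∘⟨ triangle ⟩
        α ∘ (unitorʳ ⊗₁ id) ∎))

    braiding-coherence : ∀ {X} → unitorˡ ∘ σ {X} {I} ≡ unitorʳ
    braiding-coherence {X} = ⊗I-injective (sym (split-mono-cancel σ-involutive (begin
        σ ∘ (unitorʳ ⊗₁ id) ≡⟨ refl⟩∘⟨ sym triangle ⟩
        σ ∘ (id ⊗₁ unitorˡ) ∘ α ≡⟨ trans (pullˡ σ-natural) assoc ⟩
        (unitorˡ ⊗₁ id) ∘ σ ∘ α ≡⟨ sym unitorˡ-coherence ⟩∘⟨refl ⟩
        (unitorˡ ∘ α) ∘ σ ∘ α ≡⟨ assoc ⟩
        unitorˡ ∘ α ∘ σ ∘ α ≡⟨ refl⟩∘⟨ hexagon ⟩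
        unitorˡ ∘ (id ⊗₁ σ) ∘ α ∘ (σ ⊗₁ id) ≡⟨ trans (pullˡ unitorˡ-natural) assoc ⟩
        σ ∘ unitorˡ ∘ α ∘ (σ ⊗₁ id) ≡⟨ refl⟩∘⟨ pullˡ unitorˡ-coherence ⟩
        σ ∘ (unitorˡ ⊗₁ id) ∘ (σ ⊗₁ id) ≡⟨ refl⟩∘⟨ sym split₁ˡ ⟩
        σ ∘ ((unitorˡ ∘ σ) ⊗₁ id) ∎)))

    unitorˡ-coherence⁻¹ : ∀ {X Y} → α⁻¹ {I} {X} {Y} ∘ unitorˡ⁻¹ ≡ unitorˡ⁻¹ ⊗₁ id
    unitorˡ-coherence⁻¹ = inverse-∘ unitorˡ-isoʳ α-isoʳ (⊗id-inverse unitorˡ-isoˡ) unitorˡ-coherence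

    triangle⁻¹ : ∀ {X Y} → α⁻¹ {X} {I} {Y} ∘ (id ⊗₁ unitorˡ⁻¹) ≡ unitorʳ⁻¹ ⊗₁ id
    triangle⁻¹ = inverse-∘ (id⊗-inverse unitorˡ-isoʳ) α-isoʳ (⊗id-inverse unitorʳ-isoˡ) triangle

    braiding-coherence⁻¹ : ∀ {X} → σ {X} {I} ∘ unitorʳ⁻¹ ≡ unitorˡ⁻¹
    braiding-coherence⁻¹ = begin
      σ ∘ unitorʳ⁻¹ ≡⟨ insertˡ unitorˡ-isoˡ ⟩
      unitorˡ⁻¹ ∘ unitorˡ ∘ σ ∘ unitorʳ⁻¹ ≡⟨ refl⟩∘⟨ pullˡ braiding-coherence ⟩
      unitorˡ⁻¹ ∘ unitorʳ ∘ unitorʳ⁻¹ ≡⟨ refl⟩∘⟨ unitorʳ-isoʳ ⟩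
      unitorˡ⁻¹ ∘ id ≡⟨ identityʳ ⟩
      unitorˡ⁻¹ ∎

    triangle-α⁻¹ : ∀ {X Y} → (unitorʳ {X} ⊗₁ id {Y}) ∘ α⁻¹ ≡ id ⊗₁ unitorˡ
    triangle-α⁻¹ = trans (sym triangle ⟩∘⟨refl) (trans assoc (trans (refl⟩∘⟨ α-isoʳ) identityʳ))

    unitorʳ-coherence-α⁻¹ : ∀ {X Y} → unitorʳ {X ⊗₀ Y} ∘ α⁻¹ ≡ id ⊗₁ unitorʳ
    unitorʳ-coherence-α⁻¹ = trans (sym unitorʳ-coherence ⟩∘⟨refl) (trans assoc (trans (refl⟩∘⟨ α-isoʳ) identityʳ))

    unitorˡ-coherence-cancel : ∀ {X Y} → (unitorˡ ⊗₁ id) ∘ α⁻¹ {I} {X} {Y} ∘ unitorˡ⁻¹ ≡ id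
    unitorˡ-coherence-cancel = trans (sym unitorˡ-coherence ⟩∘⟨refl) (trans assoc (trans (refl⟩∘⟨ cancelˡ α-isoʳ) unitorˡ-isoʳ))

    pentagon-α⁻¹ : ∀ {W X Y Z} → α {W ⊗₀ X} {Y} {Z} ∘ (α⁻¹ ⊗₁ id) ∘ α⁻¹ ≡ α⁻¹ ∘ (id ⊗₁ α {X} {Y} {Z})
    pentagon-α⁻¹ = sym (begin
      α⁻¹ ∘ (id ⊗₁ α) ≡⟨ refl⟩∘⟨ sym identityʳ ⟩
      α⁻¹ ∘ (id ⊗₁ α) ∘ id ≡⟨ refl⟩∘⟨ refl⟩∘⟨ sym α-isoʳ ⟩
      α⁻¹ ∘ (id ⊗₁ α) ∘ α ∘ α⁻¹ ≡⟨ refl⟩∘⟨ refl⟩∘⟨ refl⟩∘⟨ insertˡ (⊗id-inverse α-isoʳ) ⟩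
      α⁻¹ ∘ (id ⊗₁ α) ∘ α ∘ (α ⊗₁ id) ∘ (α⁻¹ ⊗₁ id) ∘ α⁻¹ ≡⟨ refl⟩∘⟨ trans (sym assoc) (trans (sym assoc) (trans assoc pentagon ⟩∘⟨refl)) ⟩
      α⁻¹ ∘ (α ∘ α) ∘ (α⁻¹ ⊗₁ id) ∘ α⁻¹ ≡⟨ refl⟩∘⟨ assoc ⟩
      α⁻¹ ∘ α ∘ α ∘ (α⁻¹ ⊗₁ id) ∘ α⁻¹ ≡⟨ cancelˡ α-isoˡ ⟩
      α ∘ (α⁻¹ ⊗₁ id) ∘ α⁻¹ ∎)

    pentagon⁻¹ : ∀ {W X Y Z} → (α⁻¹ {W} {X} {Y} ⊗₁ id {Z}) ∘ α⁻¹ ∘ (id ⊗₁ α⁻¹) ≡ α⁻¹ ∘ α⁻¹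
    pentagon⁻¹ = begin
      (α⁻¹ ⊗₁ id) ∘ α⁻¹ ∘ (id ⊗₁ α⁻¹) ≡⟨ insertˡ α⁻¹α⁻¹-αα ⟩
      (α⁻¹ ∘ α⁻¹) ∘ (α ∘ α) ∘ (α⁻¹ ⊗₁ id) ∘ α⁻¹ ∘ (id ⊗₁ α⁻¹) ≡⟨ refl⟩∘⟨ (sym pentagon ⟩∘⟨refl) ⟩
      (α⁻¹ ∘ α⁻¹) ∘ ((id ⊗₁ α) ∘ α ∘ (α ⊗₁ id)) ∘ (α⁻¹ ⊗₁ id) ∘ α⁻¹ ∘ (id ⊗₁ α⁻¹) ≡⟨ refl⟩∘⟨ trans assoc (refl⟩∘⟨ trans assoc (refl⟩∘⟨ cancelˡ (⊗id-inverse α-isoʳ))) ⟩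
      (α⁻¹ ∘ α⁻¹) ∘ (id ⊗₁ α) ∘ α ∘ α⁻¹ ∘ (id ⊗₁ α⁻¹) ≡⟨ refl⟩∘⟨ refl⟩∘⟨ cancelˡ α-isoʳ ⟩
      (α⁻¹ ∘ α⁻¹) ∘ (id ⊗₁ α) ∘ (id ⊗₁ α⁻¹) ≡⟨ refl⟩∘⟨ id⊗-inverse α-isoʳ ⟩
      (α⁻¹ ∘ α⁻¹) ∘ id ≡⟨ identityʳ ⟩
      α⁻¹ ∘ α⁻¹ ∎
      where
      α⁻¹α⁻¹-αα : ∀ {W X Y Z} → (α⁻¹ {W ⊗₀ X} {Y} {Z} ∘ α⁻¹) ∘ (α ∘ α) ≡ id
      α⁻¹α⁻¹-αα = trans assoc (trans (refl⟩∘⟨ trans (sym assoc) (trans (α-isoˡ ⟩∘⟨refl) identityˡ)) α-isoˡ)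

    σ-hexagon : ∀ {X Y Z} → σ {X} {Y ⊗₀ Z} ≡ α⁻¹ ∘ (id ⊗₁ σ) ∘ α ∘ (σ ⊗₁ id) ∘ α⁻¹
    σ-hexagon = begin
      σ ≡⟨ sym identityʳ ⟩
      σ ∘ id ≡⟨ refl⟩∘⟨ sym α-isoʳ ⟩
      σ ∘ α ∘ α⁻¹ ≡⟨ insertˡ α-isoˡ ⟩
      α⁻¹ ∘ α ∘ σ ∘ α ∘ α⁻¹ ≡⟨ refl⟩∘⟨ trans (sym assoc) (trans (sym assoc) (trans assoc hexagon ⟩∘⟨refl)) ⟩
      α⁻¹ ∘ ((id ⊗₁ σ) ∘ α ∘ (σ ⊗₁ id)) ∘ α⁻¹ ≡⟨ refl⟩∘⟨ trans assoc (refl⟩∘⟨ assoc) ⟩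
      α⁻¹ ∘ (id ⊗₁ σ) ∘ α ∘ (σ ⊗₁ id) ∘ α⁻¹ ∎

    α⁻¹-σ-α⁻¹ : ∀ {A B C} → α⁻¹ {C} {A} {B} ∘ σ {A ⊗₀ B} {C} ∘ α⁻¹ ≡ (σ {A} {C} ⊗₁ id) ∘ α⁻¹ ∘ (id ⊗₁ σ {B} {C})
    α⁻¹-σ-α⁻¹ {A} {B} {C} = begin
        α⁻¹ ∘ σ ∘ α⁻¹ ≡⟨ refl⟩∘⟨ (σ≡σ′ ⟩∘⟨refl) ⟩
        α⁻¹ ∘ (α ∘ (σ ⊗₁ id) ∘ α⁻¹ ∘ (id ⊗₁ σ) ∘ α) ∘ α⁻¹ ≡⟨ cancel-α ⟩
        (σ ⊗₁ id) ∘ α⁻¹ ∘ (id ⊗₁ σ) ∎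
      where
      σ′ : ((A ⊗₀ B) ⊗₀ C) ⇒ (C ⊗₀ (A ⊗₀ B))
      σ′ = α ∘ (σ ⊗₁ id) ∘ α⁻¹ ∘ (id ⊗₁ σ) ∘ α
      σ∘σ′ : σ {C} {A ⊗₀ B} ∘ σ′ ≡ id
      σ∘σ′ = begin
        σ ∘ σ′ ≡⟨ σ-hexagon ⟩∘⟨refl ⟩
        (α⁻¹ ∘ (id ⊗₁ σ) ∘ α ∘ (σ ⊗₁ id) ∘ α⁻¹) ∘ α ∘ (σ ⊗₁ id) ∘ α⁻¹ ∘ (id ⊗₁ σ) ∘ α
          ≡⟨ trans assoc (refl⟩∘⟨ trans assoc (refl⟩∘⟨ trans assoc (refl⟩∘⟨ trans assoc (refl⟩∘⟨ cancelˡ α-isoˡ)))) ⟩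
        α⁻¹ ∘ (id ⊗₁ σ) ∘ α ∘ (σ ⊗₁ id) ∘ (σ ⊗₁ id) ∘ α⁻¹ ∘ (id ⊗₁ σ) ∘ α
          ≡⟨ refl⟩∘⟨ refl⟩∘⟨ refl⟩∘⟨ cancelˡ (⊗id-inverse σ-involutive) ⟩
        α⁻¹ ∘ (id ⊗₁ σ) ∘ α ∘ α⁻¹ ∘ (id ⊗₁ σ) ∘ α
          ≡⟨ refl⟩∘⟨ refl⟩∘⟨ cancelˡ α-isoʳ ⟩
        α⁻¹ ∘ (id ⊗₁ σ) ∘ (id ⊗₁ σ) ∘ α
          ≡⟨ refl⟩∘⟨ cancelˡ (id⊗-inverse σ-involutive) ⟩
        α⁻¹ ∘ α ≡⟨ α-isoˡ ⟩
        id ∎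
      σ≡σ′ : σ {A ⊗₀ B} {C} ≡ σ′
      σ≡σ′ = begin
        σ ≡⟨ sym identityʳ ⟩ σ ∘ id ≡⟨ refl⟩∘⟨ sym σ∘σ′ ⟩ σ ∘ σ ∘ σ′ ≡⟨ cancelˡ σ-involutive ⟩ σ′ ∎
      cancel-α : α⁻¹ ∘ (α ∘ (σ ⊗₁ id) ∘ α⁻¹ ∘ (id ⊗₁ σ) ∘ α) ∘ α⁻¹ ≡ (σ ⊗₁ id) ∘ α⁻¹ ∘ (id ⊗₁ σ)
      cancel-α = begin
        α⁻¹ ∘ (α ∘ (σ ⊗₁ id) ∘ α⁻¹ ∘ (id ⊗₁ σ) ∘ α) ∘ α⁻¹
          ≡⟨ refl⟩∘⟨ trans assoc (refl⟩∘⟨ trans assoc (refl⟩∘⟨ trans assoc (refl⟩∘⟨ assoc))) ⟩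
        α⁻¹ ∘ α ∘ (σ ⊗₁ id) ∘ α⁻¹ ∘ (id ⊗₁ σ) ∘ α ∘ α⁻¹
          ≡⟨ cancelˡ α-isoˡ ⟩
        (σ ⊗₁ id) ∘ α⁻¹ ∘ (id ⊗₁ σ) ∘ α ∘ α⁻¹
          ≡⟨ refl⟩∘⟨ refl⟩∘⟨ refl⟩∘⟨ α-isoʳ ⟩
        (σ ⊗₁ id) ∘ α⁻¹ ∘ (id ⊗₁ σ) ∘ id
          ≡⟨ refl⟩∘⟨ refl⟩∘⟨ identityʳ ⟩
        (σ ⊗₁ id) ∘ α⁻¹ ∘ (id ⊗₁ σ) ∎

    σ-rotations : ∀ {X Y Z} → σ {X} {Y ⊗₀ Z} ≡ α⁻¹ ∘ σ {Z ⊗₀ X} {Y} ∘ α⁻¹ ∘ σ {X ⊗₀ Y} {Z} ∘ α⁻¹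
    σ-rotations {X} {Y} {Z} = sym (begin
        α⁻¹ ∘ σ ∘ α⁻¹ ∘ σ ∘ α⁻¹ ≡⟨ trans (refl⟩∘⟨ sym assoc) (sym assoc) ⟩
        (α⁻¹ ∘ σ ∘ α⁻¹) ∘ σ ∘ α⁻¹ ≡⟨ α⁻¹-σ-α⁻¹ ⟩∘⟨refl ⟩
        ((σ ⊗₁ id) ∘ α⁻¹ ∘ (id ⊗₁ σ)) ∘ σ ∘ α⁻¹ ≡⟨ trans assoc (refl⟩∘⟨ assoc) ⟩
        (σ ⊗₁ id) ∘ α⁻¹ ∘ (id ⊗₁ σ) ∘ σ ∘ α⁻¹ ≡⟨ refl⟩∘⟨ refl⟩∘⟨ pullˡ (sym σ-natural) ⟩
        (σ ⊗₁ id) ∘ α⁻¹ ∘ (σ ∘ (σ ⊗₁ id)) ∘ α⁻¹ ≡⟨ refl⟩∘⟨ refl⟩∘⟨ assoc ⟩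
        (σ ⊗₁ id) ∘ α⁻¹ ∘ σ ∘ (σ ⊗₁ id) ∘ α⁻¹ ≡⟨ refl⟩∘⟨ refl⟩∘⟨ refl⟩∘⟨ insertˡ α-isoˡ ⟩
        (σ ⊗₁ id) ∘ α⁻¹ ∘ σ ∘ α⁻¹ ∘ α ∘ (σ ⊗₁ id) ∘ α⁻¹ ≡⟨ refl⟩∘⟨ trans (sym assoc) (trans (sym assoc) (trans assoc α⁻¹-σ-α⁻¹ ⟩∘⟨refl)) ⟩
        (σ ⊗₁ id) ∘ ((σ ⊗₁ id) ∘ α⁻¹ ∘ (id ⊗₁ σ)) ∘ α ∘ (σ ⊗₁ id) ∘ α⁻¹ ≡⟨ refl⟩∘⟨ trans assoc (refl⟩∘⟨ assoc) ⟩
        (σ ⊗₁ id) ∘ (σ ⊗₁ id) ∘ α⁻¹ ∘ (id ⊗₁ σ) ∘ α ∘ (σ ⊗₁ id) ∘ α⁻¹ ≡⟨ cancelˡ (⊗id-inverse σ-involutive) ⟩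
        α⁻¹ ∘ (id ⊗₁ σ) ∘ α ∘ (σ ⊗₁ id) ∘ α⁻¹ ≡⟨ sym σ-hexagon ⟩
        σ ∎)

    α⁻¹-σ-α⁻¹-rotated : ∀ {X Y Z} → α⁻¹ {Z} {X} {Y} ∘ σ ∘ α⁻¹ ≡ σ ∘ α ∘ σ {X} {Y ⊗₀ Z}
    α⁻¹-σ-α⁻¹-rotated = sym (begin
      σ ∘ α ∘ σ ≡⟨ refl⟩∘⟨ refl⟩∘⟨ σ-rotations ⟩
      σ ∘ α ∘ α⁻¹ ∘ σ ∘ α⁻¹ ∘ σ ∘ α⁻¹ ≡⟨ refl⟩∘⟨ cancelˡ α-isoʳ ⟩
      σ ∘ σ ∘ α⁻¹ ∘ σ ∘ α⁻¹ ≡⟨ cancelˡ σ-involutive ⟩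
      α⁻¹ ∘ σ ∘ α⁻¹ ∎)

    rotate : ∀ {X Y Z} → (X ⊗₀ (Y ⊗₀ Z)) ⇒ (Y ⊗₀ (Z ⊗₀ X))
    rotate = σ ∘ α⁻¹ ∘ σ ∘ α⁻¹

    rotate-natural : ∀ {X Y Z X' Y' Z'} {x : X ⇒ X'} {y : Y ⇒ Y'} {z : Z ⇒ Z'} →
      rotate ∘ (x ⊗₁ (y ⊗₁ z)) ≡ (y ⊗₁ (z ⊗₁ x)) ∘ rotate
    rotate-natural = begin
      (σ ∘ α⁻¹ ∘ σ ∘ α⁻¹) ∘ _ ≡⟨ trans assoc (refl⟩∘⟨ trans assoc (refl⟩∘⟨ trans assoc (refl⟩∘⟨ α⁻¹-natural))) ⟩
      σ ∘ α⁻¹ ∘ σ ∘ _ ∘ α⁻¹ ≡⟨ refl⟩∘⟨ refl⟩∘⟨ trans (pullˡ σ-natural) assoc ⟩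
      σ ∘ α⁻¹ ∘ _ ∘ σ ∘ α⁻¹ ≡⟨ refl⟩∘⟨ trans (pullˡ α⁻¹-natural) assoc ⟩
      σ ∘ _ ∘ α⁻¹ ∘ σ ∘ α⁻¹ ≡⟨ trans (pullˡ σ-natural) assoc ⟩
      _ ∘ σ ∘ α⁻¹ ∘ σ ∘ α⁻¹ ∎

    rotate-unitor₁ : ∀ {X Y} → rotate {I} {X} {Y} ∘ unitorˡ⁻¹ ≡ id ⊗₁ unitorʳ⁻¹
    rotate-unitor₁ = begin
      (σ ∘ α⁻¹ ∘ σ ∘ α⁻¹) ∘ unitorˡ⁻¹ ≡⟨ trans assoc (refl⟩∘⟨ trans assoc (refl⟩∘⟨ trans assoc (refl⟩∘⟨ unitorˡ-coherence⁻¹))) ⟩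
      σ ∘ α⁻¹ ∘ σ ∘ (unitorˡ⁻¹ ⊗₁ id) ≡⟨ refl⟩∘⟨ refl⟩∘⟨ σ-natural ⟩
      σ ∘ α⁻¹ ∘ (id ⊗₁ unitorˡ⁻¹) ∘ σ ≡⟨ refl⟩∘⟨ pullˡ triangle⁻¹ ⟩
      σ ∘ (unitorʳ⁻¹ ⊗₁ id) ∘ σ ≡⟨ pullˡ σ-natural ⟩
      ((id ⊗₁ unitorʳ⁻¹) ∘ σ) ∘ σ ≡⟨ cancelʳ σ-involutive ⟩
      id ⊗₁ unitorʳ⁻¹ ∎

    rotate-unitor₃ : ∀ {X Y} → (id ⊗₁ unitorˡ) ∘ rotate {X} {Y} {I} ∘ α ∘ unitorʳ⁻¹ ≡ σ
    rotate-unitor₃ = begin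
      (id ⊗₁ unitorˡ) ∘ (σ ∘ α⁻¹ ∘ σ ∘ α⁻¹) ∘ α ∘ unitorʳ⁻¹
        ≡⟨ refl⟩∘⟨ trans assoc (refl⟩∘⟨ trans assoc (refl⟩∘⟨ trans assoc (refl⟩∘⟨ cancelˡ α-isoˡ))) ⟩
      (id ⊗₁ unitorˡ) ∘ σ ∘ α⁻¹ ∘ σ ∘ unitorʳ⁻¹ ≡⟨ refl⟩∘⟨ refl⟩∘⟨ refl⟩∘⟨ braiding-coherence⁻¹ ⟩
      (id ⊗₁ unitorˡ) ∘ σ ∘ α⁻¹ ∘ unitorˡ⁻¹ ≡⟨ refl⟩∘⟨ refl⟩∘⟨ unitorˡ-coherence⁻¹ ⟩
      (id ⊗₁ unitorˡ) ∘ σ ∘ (unitorˡ⁻¹ ⊗₁ id) ≡⟨ refl⟩∘⟨ σ-natural ⟩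
      (id ⊗₁ unitorˡ) ∘ (id ⊗₁ unitorˡ⁻¹) ∘ σ ≡⟨ cancelˡ (id⊗-inverse unitorˡ-isoʳ) ⟩
      σ ∎

  module ClosedReasoning where
    open MonoidalReasoning

    curry-natural : ∀ {X Y Y' Z} {f : (X ⊗₀ Y) ⇒ Z} {g : Y' ⇒ Y} → curry f ∘ g ≡ curry (f ∘ (id ⊗₁ g))
    curry-natural {f = f} {g} = begin
      curry f ∘ g ≡⟨ sym curry-unique ⟩
      curry (ev ∘ (id ⊗₁ (curry f ∘ g))) ≡⟨ cong curry (refl⟩∘⟨ split₂ˡ) ⟩
      curry (ev ∘ (id ⊗₁ curry f) ∘ (id ⊗₁ g)) ≡⟨ cong curry (pullˡ ev-curry) ⟩
      curry (f ∘ (id ⊗₁ g)) ∎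

    uncurry-injective : ∀ {X Y Z} {g g' : Y ⇒ [ X , Z ]} → ev ∘ (id ⊗₁ g) ≡ ev ∘ (id ⊗₁ g') → g ≡ g'
    uncurry-injective {g = g} {g'} p = trans (sym curry-unique) (trans (cong curry p) curry-unique)

    name : ∀ {X Y} → X ⇒ Y → I ⇒ [ X , Y ]
    name f = curry (f ∘ unitorʳ)

    ev-name : ∀ {X Y} {f : X ⇒ Y} → ev ∘ (id ⊗₁ name f) ≡ f ∘ unitorʳ
    ev-name = ev-curry

    ev-j⁻¹ : ∀ {X} (j⁻ : [ [ X , I ] , I ] ⇒ X) → jmap V X ∘ j⁻ ≡ id →
      ev {X} {I} ∘ (j⁻ ⊗₁ id) ≡ ev {[ X , I ]} {I} ∘ σ
    ev-j⁻¹ {X} j⁻ jj = begin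
      ev ∘ (j⁻ ⊗₁ id) ≡⟨ trans (refl⟩∘⟨ insertˡ σ-involutive) (sym assoc) ⟩
      (ev ∘ σ) ∘ σ ∘ (j⁻ ⊗₁ id) ≡⟨ sym ev-curry ⟩∘⟨refl ⟩
      (ev ∘ (id ⊗₁ jmap V X)) ∘ σ ∘ (j⁻ ⊗₁ id) ≡⟨ refl⟩∘⟨ σ-natural ⟩
      (ev ∘ (id ⊗₁ jmap V X)) ∘ (id ⊗₁ j⁻) ∘ σ ≡⟨ trans assoc (refl⟩∘⟨ pullˡ (trans (sym split₂ˡ) (trans (refl ⟩⊗⟨ jj) ⊗-id))) ⟩
      ev ∘ id ∘ σ ≡⟨ refl⟩∘⟨ identityˡ ⟩
      ev ∘ σ ∎

    ev-unitorˡ : ∀ {X Y} → ev {X} {Y} ∘ (unitorˡ ⊗₁ id) ≡ unitorˡ ∘ (id ⊗₁ ev) ∘ α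
    ev-unitorˡ = trans (refl⟩∘⟨ sym unitorˡ-coherence) (trans (pullˡ (sym unitorˡ-natural)) assoc)

    -- compose (f ⊗ g) = g ∘ f; at X = Y = Z = A it is icomp V A.
    compose : ∀ {X Y Z} → ([ X , Y ] ⊗₀ [ Y , Z ]) ⇒ [ X , Z ]
    compose = curry (ev ∘ (ev ⊗₁ id) ∘ α⁻¹)

    compose-natural : ∀ {X Y Z P Q} {f : P ⇒ [ X , Y ]} {g : Q ⇒ [ Y , Z ]} →
      compose ∘ (f ⊗₁ g) ≡ curry (ev ∘ ((ev ∘ (id ⊗₁ f)) ⊗₁ g) ∘ α⁻¹)
    compose-natural {f = f} {g} = begin
      compose ∘ (f ⊗₁ g) ≡⟨ curry-natural ⟩
      curry ((ev ∘ (ev ⊗₁ id) ∘ α⁻¹) ∘ (id ⊗₁ (f ⊗₁ g))) ≡⟨ cong curry (trans assoc (refl⟩∘⟨ trans assoc (refl⟩∘⟨ α⁻¹-natural))) ⟩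
      curry (ev ∘ (ev ⊗₁ id) ∘ ((id ⊗₁ f) ⊗₁ g) ∘ α⁻¹) ≡⟨ cong curry (refl⟩∘⟨ pullˡ (sym (trans (refl ⟩⊗⟨ sym identityˡ) ⊗-∘))) ⟩
      curry (ev ∘ ((ev ∘ (id ⊗₁ f)) ⊗₁ g) ∘ α⁻¹) ∎

  module FrobeniusProperties {A B : Obj} {ε : (A ⊗₀ B) ⇒ I} {μ : (A ⊗₀ A) ⇒ A} {l r : A ⇒ B}
                             (fr : IsFrobenius V A B ε μ l r) where
    open IsFrobenius fr
    open MonoidalReasoning

    ε-l-r : ε ∘ (id ⊗₁ l) ≡ ε ∘ (id ⊗₁ r) ∘ σ
    ε-l-r = begin
      ε ∘ (id ⊗₁ l) ≡⟨ refl⟩∘⟨ sym (trans (refl⟩∘⟨ σ-involutive) identityʳ) ⟩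
      ε ∘ (id ⊗₁ l) ∘ σ ∘ σ ≡⟨ trans (refl⟩∘⟨ sym assoc) (sym assoc) ⟩
      (ε ∘ (id ⊗₁ l) ∘ σ) ∘ σ ≡⟨ sym ε-lr ⟩∘⟨refl ⟩
      (ε ∘ (id ⊗₁ r)) ∘ σ ≡⟨ assoc ⟩
      ε ∘ (id ⊗₁ r) ∘ σ ∎

    cyclic : ε ∘ (μ ⊗₁ r) ∘ α⁻¹ ≡ ε ∘ (id ⊗₁ (r ∘ μ)) ∘ rotate
    cyclic = begin
      ε ∘ (μ ⊗₁ r) ∘ α⁻¹ ≡⟨ refl⟩∘⟨ (trans serialize₁₂ (refl⟩∘⟨ (sym ⊗-id ⟩⊗⟨ refl)) ⟩∘⟨refl) ⟩
      ε ∘ ((μ ⊗₁ id) ∘ ((id ⊗₁ id) ⊗₁ r)) ∘ α⁻¹ ≡⟨ refl⟩∘⟨ trans assoc (refl⟩∘⟨ sym α⁻¹-natural) ⟩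
      ε ∘ (μ ⊗₁ id) ∘ α⁻¹ ∘ (id ⊗₁ (id ⊗₁ r)) ≡⟨ trans (sym assoc) (trans (sym assoc) (trans assoc (sym ◁-def) ⟩∘⟨refl)) ⟩
      (ε ∘ (id ⊗₁ ◁)) ∘ (id ⊗₁ (id ⊗₁ r)) ≡⟨ trans assoc (refl⟩∘⟨ trans (sym split₂ˡ) (refl ⟩⊗⟨ act-lr)) ⟩
      ε ∘ (id ⊗₁ (▷ ∘ (l ⊗₁ id))) ≡⟨ trans (refl⟩∘⟨ split₂ˡ) (sym assoc) ⟩
      (ε ∘ (id ⊗₁ ▷)) ∘ (id ⊗₁ (l ⊗₁ id)) ≡⟨ ▷-def ⟩∘⟨refl ⟩
      (ε ∘ (μ ⊗₁ id) ∘ α⁻¹ ∘ σ ∘ α⁻¹) ∘ (id ⊗₁ (l ⊗₁ id)) ≡⟨ trans assoc (refl⟩∘⟨ trans assoc (refl⟩∘⟨ trans assoc (refl⟩∘⟨ trans assoc (refl⟩∘⟨ α⁻¹-natural)))) ⟩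
      ε ∘ (μ ⊗₁ id) ∘ α⁻¹ ∘ σ ∘ ((id ⊗₁ l) ⊗₁ id) ∘ α⁻¹ ≡⟨ refl⟩∘⟨ refl⟩∘⟨ refl⟩∘⟨ trans (pullˡ σ-natural) assoc ⟩
      ε ∘ (μ ⊗₁ id) ∘ α⁻¹ ∘ (id ⊗₁ (id ⊗₁ l)) ∘ σ ∘ α⁻¹ ≡⟨ refl⟩∘⟨ refl⟩∘⟨ trans (pullˡ α⁻¹-natural) assoc ⟩
      ε ∘ (μ ⊗₁ id) ∘ ((id ⊗₁ id) ⊗₁ l) ∘ α⁻¹ ∘ σ ∘ α⁻¹ ≡⟨ refl⟩∘⟨ pullˡ (trans (sym ⊗-∘) (trans (trans (refl⟩∘⟨ ⊗-id) identityʳ ⟩⊗⟨ identityˡ) serialize₂₁)) ⟩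
      ε ∘ ((id ⊗₁ l) ∘ (μ ⊗₁ id)) ∘ α⁻¹ ∘ σ ∘ α⁻¹ ≡⟨ trans (refl⟩∘⟨ assoc) (sym assoc) ⟩
      (ε ∘ (id ⊗₁ l)) ∘ (μ ⊗₁ id) ∘ α⁻¹ ∘ σ ∘ α⁻¹ ≡⟨ ε-l-r ⟩∘⟨refl ⟩
      (ε ∘ (id ⊗₁ r) ∘ σ) ∘ (μ ⊗₁ id) ∘ α⁻¹ ∘ σ ∘ α⁻¹ ≡⟨ trans assoc (refl⟩∘⟨ trans assoc (refl⟩∘⟨ trans (pullˡ σ-natural) assoc)) ⟩
      ε ∘ (id ⊗₁ r) ∘ (id ⊗₁ μ) ∘ σ ∘ α⁻¹ ∘ σ ∘ α⁻¹ ≡⟨ refl⟩∘⟨ pullˡ (sym split₂ˡ) ⟩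
      ε ∘ (id ⊗₁ (r ∘ μ)) ∘ σ ∘ α⁻¹ ∘ σ ∘ α⁻¹ ∎

  module PseudoAffineEndomorphisms {A : Obj} (p : I ⇒ A) (c : A ⇒ I) (cp : c ∘ p ≡ id) where
    open MonoidalReasoning
    open ClosedReasoning

    M : Obj
    M = [ A , A ]

    A* : Obj
    A* = [ A , I ]

    D : Obj
    D = A* ⊗₀ A

    μ : (M ⊗₀ M) ⇒ M
    μ = icomp V A

    mixA : D ⇒ M
    mixA = mix V A

    post-p : A* ⇒ M
    post-p = curry (p ∘ ev)

    c-scale : A ⇒ M
    c-scale = curry (unitorˡ ∘ (c ⊗₁ id))

    e : A ⇒ A
    e = p ∘ c

    ⌜e⌝ : I ⇒ M
    ⌜e⌝ = name e

    post-e : M ⇒ M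
    post-e = curry (e ∘ ev)

    post-c : M ⇒ A*
    post-c = curry (c ∘ ev)

    precompose : (M ⊗₀ A*) ⇒ A*
    precompose = compose {A} {A} {I}

    at-p : M ⇒ A
    at-p = ev ∘ (p ⊗₁ id) ∘ unitorˡ⁻¹

    mix-factors : μ ∘ (post-p ⊗₁ c-scale) ≡ mixA
    mix-factors = trans compose-natural (cong curry (begin
      ev ∘ ((ev ∘ (id ⊗₁ post-p)) ⊗₁ c-scale) ∘ α⁻¹ ≡⟨ refl⟩∘⟨ ((ev-curry ⟩⊗⟨ refl) ⟩∘⟨refl) ⟩
      ev ∘ ((p ∘ ev) ⊗₁ c-scale) ∘ α⁻¹ ≡⟨ refl⟩∘⟨ (serialize₂₁ ⟩∘⟨refl) ⟩
      ev ∘ ((id ⊗₁ c-scale) ∘ ((p ∘ ev) ⊗₁ id)) ∘ α⁻¹ ≡⟨ refl⟩∘⟨ assoc ⟩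
      ev ∘ (id ⊗₁ c-scale) ∘ ((p ∘ ev) ⊗₁ id) ∘ α⁻¹ ≡⟨ pullˡ ev-curry ⟩
      (unitorˡ ∘ (c ⊗₁ id)) ∘ ((p ∘ ev) ⊗₁ id) ∘ α⁻¹ ≡⟨ trans assoc (refl⟩∘⟨ pullˡ merge₁) ⟩
      unitorˡ ∘ ((c ∘ p ∘ ev) ⊗₁ id) ∘ α⁻¹ ≡⟨ refl⟩∘⟨ ((trans (sym assoc) (trans (cp ⟩∘⟨refl) identityˡ) ⟩⊗⟨ refl) ⟩∘⟨refl) ⟩
      unitorˡ ∘ (ev ⊗₁ id) ∘ α⁻¹ ∎))

    μ-⌜e⌝ʳ : μ ∘ (id ⊗₁ ⌜e⌝) ≡ post-e ∘ unitorʳ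
    μ-⌜e⌝ʳ = trans compose-natural (trans (cong curry (begin
      ev ∘ ((ev ∘ (id ⊗₁ id)) ⊗₁ ⌜e⌝) ∘ α⁻¹ ≡⟨ refl⟩∘⟨ ((trans (refl⟩∘⟨ ⊗-id) identityʳ ⟩⊗⟨ refl) ⟩∘⟨refl) ⟩
      ev ∘ (ev ⊗₁ ⌜e⌝) ∘ α⁻¹ ≡⟨ refl⟩∘⟨ (serialize₂₁ ⟩∘⟨refl) ⟩
      ev ∘ ((id ⊗₁ ⌜e⌝) ∘ (ev ⊗₁ id)) ∘ α⁻¹ ≡⟨ trans (refl⟩∘⟨ assoc) (pullˡ ev-name) ⟩
      (e ∘ unitorʳ) ∘ (ev ⊗₁ id) ∘ α⁻¹ ≡⟨ trans assoc (refl⟩∘⟨ pullˡ unitorʳ-natural) ⟩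
      e ∘ (ev ∘ unitorʳ) ∘ α⁻¹ ≡⟨ refl⟩∘⟨ trans assoc (refl⟩∘⟨ unitorʳ-coherence-α⁻¹) ⟩
      e ∘ ev ∘ (id ⊗₁ unitorʳ) ≡⟨ sym assoc ⟩
      (e ∘ ev) ∘ (id ⊗₁ unitorʳ) ∎)) (sym curry-natural))

    μ-⌜e⌝-c-scale : μ ∘ (⌜e⌝ ⊗₁ c-scale) ≡ c-scale ∘ unitorˡ
    μ-⌜e⌝-c-scale = trans compose-natural (trans (cong curry (begin
      ev ∘ ((ev ∘ (id ⊗₁ ⌜e⌝)) ⊗₁ c-scale) ∘ α⁻¹ ≡⟨ refl⟩∘⟨ ((ev-name ⟩⊗⟨ refl) ⟩∘⟨refl) ⟩
      ev ∘ ((e ∘ unitorʳ) ⊗₁ c-scale) ∘ α⁻¹ ≡⟨ refl⟩∘⟨ (serialize₂₁ ⟩∘⟨refl) ⟩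
      ev ∘ ((id ⊗₁ c-scale) ∘ ((e ∘ unitorʳ) ⊗₁ id)) ∘ α⁻¹ ≡⟨ trans (refl⟩∘⟨ assoc) (pullˡ ev-curry) ⟩
      (unitorˡ ∘ (c ⊗₁ id)) ∘ ((e ∘ unitorʳ) ⊗₁ id) ∘ α⁻¹ ≡⟨ trans assoc (refl⟩∘⟨ pullˡ merge₁) ⟩
      unitorˡ ∘ ((c ∘ e ∘ unitorʳ) ⊗₁ id) ∘ α⁻¹ ≡⟨ refl⟩∘⟨ ((c-e ⟩⊗⟨ refl) ⟩∘⟨refl) ⟩
      unitorˡ ∘ ((c ∘ unitorʳ) ⊗₁ id) ∘ α⁻¹ ≡⟨ refl⟩∘⟨ trans (split₁ˡ ⟩∘⟨refl) assoc ⟩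
      unitorˡ ∘ (c ⊗₁ id) ∘ (unitorʳ ⊗₁ id) ∘ α⁻¹ ≡⟨ refl⟩∘⟨ refl⟩∘⟨ triangle-α⁻¹ ⟩
      unitorˡ ∘ (c ⊗₁ id) ∘ (id ⊗₁ unitorˡ) ≡⟨ sym assoc ⟩
      (unitorˡ ∘ (c ⊗₁ id)) ∘ (id ⊗₁ unitorˡ) ∎)) (sym curry-natural))
      where
      c-e : c ∘ e ∘ unitorʳ ≡ c ∘ unitorʳ
      c-e = trans (refl⟩∘⟨ assoc) (trans (sym assoc) (trans (cp ⟩∘⟨refl) identityˡ))

    post-p-post-c : post-p ∘ post-c ≡ post-e
    post-p-post-c = trans curry-natural (cong curry (trans assoc (trans (refl⟩∘⟨ ev-curry) (sym assoc))))

    at-p-c-scale : at-p ∘ c-scale ≡ id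
    at-p-c-scale = begin
      (ev ∘ (p ⊗₁ id) ∘ unitorˡ⁻¹) ∘ c-scale ≡⟨ trans assoc (refl⟩∘⟨ trans assoc (refl⟩∘⟨ unitorˡ⁻¹-natural)) ⟩
      ev ∘ (p ⊗₁ id) ∘ (id ⊗₁ c-scale) ∘ unitorˡ⁻¹ ≡⟨ refl⟩∘⟨ pullˡ (sym serialize₁₂) ⟩
      ev ∘ (p ⊗₁ c-scale) ∘ unitorˡ⁻¹ ≡⟨ refl⟩∘⟨ (serialize₂₁ ⟩∘⟨refl) ⟩
      ev ∘ ((id ⊗₁ c-scale) ∘ (p ⊗₁ id)) ∘ unitorˡ⁻¹ ≡⟨ trans (refl⟩∘⟨ assoc) (pullˡ ev-curry) ⟩
      (unitorˡ ∘ (c ⊗₁ id)) ∘ (p ⊗₁ id) ∘ unitorˡ⁻¹ ≡⟨ trans assoc (refl⟩∘⟨ pullˡ (trans merge₁ (cp ⟩⊗⟨ refl))) ⟩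
      unitorˡ ∘ (id ⊗₁ id) ∘ unitorˡ⁻¹ ≡⟨ refl⟩∘⟨ trans (⊗-id ⟩∘⟨refl) identityˡ ⟩
      unitorˡ ∘ unitorˡ⁻¹ ≡⟨ unitorˡ-isoʳ ⟩
      id ∎

    μ-mixʳ : μ ∘ (id ⊗₁ mixA) ≡ mixA ∘ (precompose ⊗₁ id) ∘ α⁻¹
    μ-mixʳ = trans compose-natural (trans (cong curry (begin
      ev ∘ ((ev ∘ (id ⊗₁ id)) ⊗₁ mixA) ∘ α⁻¹ ≡⟨ refl⟩∘⟨ ((trans (refl⟩∘⟨ ⊗-id) identityʳ ⟩⊗⟨ refl) ⟩∘⟨refl) ⟩
      ev ∘ (ev ⊗₁ mixA) ∘ α⁻¹ ≡⟨ refl⟩∘⟨ (serialize₂₁ ⟩∘⟨refl) ⟩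
      ev ∘ ((id ⊗₁ mixA) ∘ (ev ⊗₁ id)) ∘ α⁻¹ ≡⟨ trans (refl⟩∘⟨ assoc) (pullˡ ev-curry) ⟩
      (unitorˡ ∘ (ev ⊗₁ id) ∘ α⁻¹) ∘ (ev ⊗₁ id) ∘ α⁻¹ ≡⟨ trans assoc (refl⟩∘⟨ trans assoc (refl⟩∘⟨ trans (pullˡ (trans (refl⟩∘⟨ (refl ⟩⊗⟨ sym ⊗-id)) α⁻¹-natural)) assoc)) ⟩
      unitorˡ ∘ (ev ⊗₁ id) ∘ ((ev ⊗₁ id) ⊗₁ id) ∘ α⁻¹ ∘ α⁻¹ ≡⟨ refl⟩∘⟨ refl⟩∘⟨ refl⟩∘⟨ sym pentagon⁻¹ ⟩
      unitorˡ ∘ (ev ⊗₁ id) ∘ ((ev ⊗₁ id) ⊗₁ id) ∘ (α⁻¹ ⊗₁ id) ∘ α⁻¹ ∘ (id ⊗₁ α⁻¹) ≡⟨ refl⟩∘⟨ trans (sym assoc) (trans (sym assoc) (trans assoc (trans (refl⟩∘⟨ sym split₁ˡ) (sym split₁ˡ)) ⟩∘⟨refl)) ⟩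
      unitorˡ ∘ ((ev ∘ (ev ⊗₁ id) ∘ α⁻¹) ⊗₁ id) ∘ α⁻¹ ∘ (id ⊗₁ α⁻¹) ≡⟨ refl⟩∘⟨ ((sym ev-curry ⟩⊗⟨ refl) ⟩∘⟨refl) ⟩
      unitorˡ ∘ ((ev ∘ (id ⊗₁ precompose)) ⊗₁ id) ∘ α⁻¹ ∘ (id ⊗₁ α⁻¹) ≡⟨ refl⟩∘⟨ trans (split₁ˡ ⟩∘⟨refl) assoc ⟩
      unitorˡ ∘ (ev ⊗₁ id) ∘ ((id ⊗₁ precompose) ⊗₁ id) ∘ α⁻¹ ∘ (id ⊗₁ α⁻¹) ≡⟨ refl⟩∘⟨ refl⟩∘⟨ pullˡ (sym α⁻¹-natural) ⟩
      unitorˡ ∘ (ev ⊗₁ id) ∘ (α⁻¹ ∘ (id ⊗₁ (precompose ⊗₁ id))) ∘ (id ⊗₁ α⁻¹) ≡⟨ refl⟩∘⟨ refl⟩∘⟨ trans assoc (refl⟩∘⟨ sym split₂ˡ) ⟩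
      unitorˡ ∘ (ev ⊗₁ id) ∘ α⁻¹ ∘ (id ⊗₁ ((precompose ⊗₁ id) ∘ α⁻¹)) ≡⟨ trans (sym assoc) (trans (sym assoc) (assoc ⟩∘⟨refl)) ⟩
      (unitorˡ ∘ (ev ⊗₁ id) ∘ α⁻¹) ∘ (id ⊗₁ ((precompose ⊗₁ id) ∘ α⁻¹)) ∎)) (sym curry-natural))

    μ-mixˡ : μ ∘ (mixA ⊗₁ id) ≡ mixA ∘ (id ⊗₁ ev) ∘ α
    μ-mixˡ = trans compose-natural (trans (cong curry (begin
      ev ∘ ((ev ∘ (id ⊗₁ mixA)) ⊗₁ id) ∘ α⁻¹ ≡⟨ refl⟩∘⟨ ((ev-curry ⟩⊗⟨ refl) ⟩∘⟨refl) ⟩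
      ev ∘ ((unitorˡ ∘ (ev ⊗₁ id) ∘ α⁻¹) ⊗₁ id) ∘ α⁻¹ ≡⟨ refl⟩∘⟨ trans (split₁ˡ ⟩∘⟨refl) assoc ⟩
      ev ∘ (unitorˡ ⊗₁ id) ∘ (((ev ⊗₁ id) ∘ α⁻¹) ⊗₁ id) ∘ α⁻¹ ≡⟨ pullˡ ev-unitorˡ ⟩
      (unitorˡ ∘ (id ⊗₁ ev) ∘ α) ∘ (((ev ⊗₁ id) ∘ α⁻¹) ⊗₁ id) ∘ α⁻¹ ≡⟨ trans assoc (refl⟩∘⟨ trans assoc (refl⟩∘⟨ refl⟩∘⟨ trans (split₁ˡ ⟩∘⟨refl) assoc)) ⟩
      unitorˡ ∘ (id ⊗₁ ev) ∘ α ∘ ((ev ⊗₁ id) ⊗₁ id) ∘ (α⁻¹ ⊗₁ id) ∘ α⁻¹ ≡⟨ refl⟩∘⟨ refl⟩∘⟨ trans (pullˡ α-natural) assoc ⟩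
      unitorˡ ∘ (id ⊗₁ ev) ∘ (ev ⊗₁ (id ⊗₁ id)) ∘ α ∘ (α⁻¹ ⊗₁ id) ∘ α⁻¹ ≡⟨ refl⟩∘⟨ pullˡ (trans (sym ⊗-∘) (identityˡ ⟩⊗⟨ trans (refl⟩∘⟨ ⊗-id) identityʳ)) ⟩
      unitorˡ ∘ (ev ⊗₁ ev) ∘ α ∘ (α⁻¹ ⊗₁ id) ∘ α⁻¹ ≡⟨ refl⟩∘⟨ refl⟩∘⟨ pentagon-α⁻¹ ⟩
      unitorˡ ∘ (ev ⊗₁ ev) ∘ α⁻¹ ∘ (id ⊗₁ α) ≡⟨ refl⟩∘⟨ (trans (sym (identityʳ ⟩⊗⟨ identityˡ)) ⊗-∘ ⟩∘⟨refl) ⟩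
      unitorˡ ∘ ((ev ⊗₁ id) ∘ (id ⊗₁ ev)) ∘ α⁻¹ ∘ (id ⊗₁ α) ≡⟨ refl⟩∘⟨ assoc ⟩
      unitorˡ ∘ (ev ⊗₁ id) ∘ (id ⊗₁ ev) ∘ α⁻¹ ∘ (id ⊗₁ α) ≡⟨ refl⟩∘⟨ refl⟩∘⟨ trans (pullˡ (sym α⁻¹-natural₃)) assoc ⟩
      unitorˡ ∘ (ev ⊗₁ id) ∘ α⁻¹ ∘ (id ⊗₁ (id ⊗₁ ev)) ∘ (id ⊗₁ α) ≡⟨ refl⟩∘⟨ refl⟩∘⟨ refl⟩∘⟨ sym split₂ˡ ⟩
      unitorˡ ∘ (ev ⊗₁ id) ∘ α⁻¹ ∘ (id ⊗₁ ((id ⊗₁ ev) ∘ α)) ≡⟨ trans (sym assoc) (sym assoc) ⟩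
      ((unitorˡ ∘ (ev ⊗₁ id)) ∘ α⁻¹) ∘ (id ⊗₁ ((id ⊗₁ ev) ∘ α)) ≡⟨ assoc ⟩∘⟨refl ⟩
      (unitorˡ ∘ (ev ⊗₁ id) ∘ α⁻¹) ∘ (id ⊗₁ ((id ⊗₁ ev) ∘ α)) ∎)) (sym curry-natural))

  module FrobeniusTrace {A : Obj} (p : I ⇒ A) (c : A ⇒ I) (cp : c ∘ p ≡ id) (jA : IsIso V (jmap V A))
                       {B : Obj} {ε : ([ A , A ] ⊗₀ B) ⇒ I} {l r : [ A , A ] ⇒ B}
                       (fr : IsFrobenius V [ A , A ] B ε (icomp V A) l r) where
    open MonoidalReasoning
    open ClosedReasoning
    open PseudoAffineEndomorphisms p c cp
    open IsFrobenius fr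
    open FrobeniusProperties fr

    jA⁻ : [ [ A , I ] , I ] ⇒ A
    jA⁻ = proj₁ jA

    jA-l : jA⁻ ∘ jmap V A ≡ id
    jA-l = proj₁ (proj₂ jA)

    jA-r : jmap V A ∘ jA⁻ ≡ id
    jA-r = proj₂ (proj₂ jA)

    r⁻ : B ⇒ M
    r⁻ = proj₁ r-iso

    r-r⁻ : r ∘ r⁻ ≡ id
    r-r⁻ = proj₂ (proj₂ r-iso)

    φ-at-f-p : (M ⊗₀ A*) ⇒ I
    φ-at-f-p = ev ∘ (at-p ⊗₁ id)

    s : A* ⇒ B
    s = proj₁ (proj₂ (proj₁ dual A*) φ-at-f-p)

    s-eq : ε ∘ (id ⊗₁ s) ≡ φ-at-f-p
    s-eq = proj₂ (proj₂ (proj₁ dual A*) φ-at-f-p) refl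

    t : A* ⇒ M
    t = r⁻ ∘ s

    δ : A* ⇒ A*
    δ = post-c ∘ t

    δ-pairing : (A* ⊗₀ A) ⇒ I
    δ-pairing = ev ∘ σ ∘ (δ ⊗₁ id)

    v : A ⇒ A
    v = jA⁻ ∘ curry δ-pairing

    ⌜v⌝ : I ⇒ M
    ⌜v⌝ = name v

    pre-v : M ⇒ M
    pre-v = curry (ev ∘ (v ⊗₁ id))

    trace : M ⇒ I
    trace = ε ∘ (id ⊗₁ (r ∘ ⌜v⌝)) ∘ unitorʳ⁻¹

    v-transpose : ev {A} {I} ∘ (v ⊗₁ id) ≡ ev ∘ (id ⊗₁ δ)
    v-transpose = begin
      ev ∘ ((jA⁻ ∘ curry δ-pairing) ⊗₁ id) ≡⟨ refl⟩∘⟨ split₁ˡ ⟩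
      ev ∘ (jA⁻ ⊗₁ id) ∘ (curry δ-pairing ⊗₁ id) ≡⟨ pullˡ (ev-j⁻¹ jA⁻ jA-r) ⟩
      (ev ∘ σ) ∘ (curry δ-pairing ⊗₁ id) ≡⟨ trans assoc (refl⟩∘⟨ σ-natural) ⟩
      ev ∘ (id ⊗₁ curry δ-pairing) ∘ σ ≡⟨ pullˡ ev-curry ⟩
      (ev ∘ σ ∘ (δ ⊗₁ id)) ∘ σ ≡⟨ trans assoc (refl⟩∘⟨ trans assoc (refl⟩∘⟨ sym σ-natural)) ⟩
      ev ∘ σ ∘ σ ∘ (id ⊗₁ δ) ≡⟨ refl⟩∘⟨ cancelˡ σ-involutive ⟩
      ev ∘ (id ⊗₁ δ) ∎

    pre-v-post-p : pre-v ∘ post-p ≡ post-p ∘ δ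
    pre-v-post-p = begin
      pre-v ∘ post-p ≡⟨ curry-natural ⟩
      curry ((ev ∘ (v ⊗₁ id)) ∘ (id ⊗₁ post-p)) ≡⟨ cong curry (trans assoc (refl⟩∘⟨ ⊗id-id⊗-commute)) ⟩
      curry (ev ∘ (id ⊗₁ post-p) ∘ (v ⊗₁ id)) ≡⟨ cong curry (pullˡ ev-curry) ⟩
      curry ((p ∘ ev) ∘ (v ⊗₁ id)) ≡⟨ cong curry (trans assoc (refl⟩∘⟨ v-transpose)) ⟩
      curry (p ∘ ev ∘ (id ⊗₁ δ)) ≡⟨ cong curry (sym assoc) ⟩
      curry ((p ∘ ev) ∘ (id ⊗₁ δ)) ≡⟨ sym curry-natural ⟩
      post-p ∘ δ ∎

    μ-⌜v⌝ˡ : μ ∘ (⌜v⌝ ⊗₁ id) ≡ pre-v ∘ unitorˡ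
    μ-⌜v⌝ˡ = trans compose-natural (trans (cong curry (begin
      ev ∘ ((ev ∘ (id ⊗₁ ⌜v⌝)) ⊗₁ id) ∘ α⁻¹ ≡⟨ refl⟩∘⟨ ((ev-name ⟩⊗⟨ refl) ⟩∘⟨refl) ⟩
      ev ∘ ((v ∘ unitorʳ) ⊗₁ id) ∘ α⁻¹ ≡⟨ refl⟩∘⟨ trans (split₁ˡ ⟩∘⟨refl) assoc ⟩
      ev ∘ (v ⊗₁ id) ∘ (unitorʳ ⊗₁ id) ∘ α⁻¹ ≡⟨ refl⟩∘⟨ refl⟩∘⟨ triangle-α⁻¹ ⟩
      ev ∘ (v ⊗₁ id) ∘ (id ⊗₁ unitorˡ) ≡⟨ sym assoc ⟩
      (ev ∘ (v ⊗₁ id)) ∘ (id ⊗₁ unitorˡ) ∎)) (sym curry-natural))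

    μ-⌜v⌝-post-p : μ ∘ (⌜v⌝ ⊗₁ post-p) ≡ post-p ∘ δ ∘ unitorˡ
    μ-⌜v⌝-post-p = begin
      μ ∘ (⌜v⌝ ⊗₁ post-p) ≡⟨ refl⟩∘⟨ serialize₁₂ ⟩
      μ ∘ (⌜v⌝ ⊗₁ id) ∘ (id ⊗₁ post-p) ≡⟨ pullˡ μ-⌜v⌝ˡ ⟩
      (pre-v ∘ unitorˡ) ∘ (id ⊗₁ post-p) ≡⟨ trans assoc (refl⟩∘⟨ unitorˡ-natural) ⟩
      pre-v ∘ post-p ∘ unitorˡ ≡⟨ pullˡ pre-v-post-p ⟩
      (post-p ∘ δ) ∘ unitorˡ ≡⟨ assoc ⟩
      post-p ∘ δ ∘ unitorˡ ∎

    post-e-t : post-e ∘ t ≡ μ ∘ (t ⊗₁ ⌜e⌝) ∘ unitorʳ⁻¹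
    post-e-t = begin
      post-e ∘ t ≡⟨ sym (trans assoc (refl⟩∘⟨ cancelˡ unitorʳ-isoʳ)) ⟩
      (post-e ∘ unitorʳ) ∘ unitorʳ⁻¹ ∘ t ≡⟨ sym μ-⌜e⌝ʳ ⟩∘⟨refl ⟩
      (μ ∘ (id ⊗₁ ⌜e⌝)) ∘ unitorʳ⁻¹ ∘ t ≡⟨ refl⟩∘⟨ unitorʳ⁻¹-natural ⟩
      (μ ∘ (id ⊗₁ ⌜e⌝)) ∘ (t ⊗₁ id) ∘ unitorʳ⁻¹ ≡⟨ trans assoc (refl⟩∘⟨ pullˡ merge₂) ⟩
      μ ∘ (t ⊗₁ (⌜e⌝ ∘ id)) ∘ unitorʳ⁻¹ ≡⟨ refl⟩∘⟨ ((refl ⟩⊗⟨ identityʳ) ⟩∘⟨refl) ⟩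
      μ ∘ (t ⊗₁ ⌜e⌝) ∘ unitorʳ⁻¹ ∎

    pairing-c-scale-post-e-t : ε ∘ (c-scale ⊗₁ (r ∘ post-e ∘ t)) ≡ ε ∘ (c-scale ⊗₁ s)
    pairing-c-scale-post-e-t = begin
      ε ∘ (c-scale ⊗₁ (r ∘ post-e ∘ t)) ≡⟨ refl⟩∘⟨ (refl ⟩⊗⟨ refl⟩∘⟨ post-e-t) ⟩
      ε ∘ (c-scale ⊗₁ (r ∘ μ ∘ (t ⊗₁ ⌜e⌝) ∘ unitorʳ⁻¹)) ≡⟨ refl⟩∘⟨ sym merge-c-scale ⟩
      ε ∘ (id ⊗₁ (r ∘ μ)) ∘ (c-scale ⊗₁ (t ⊗₁ ⌜e⌝)) ∘ (id ⊗₁ unitorʳ⁻¹) ≡⟨ refl⟩∘⟨ refl⟩∘⟨ refl⟩∘⟨ sym rotate-unitor₁ ⟩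
      ε ∘ (id ⊗₁ (r ∘ μ)) ∘ (c-scale ⊗₁ (t ⊗₁ ⌜e⌝)) ∘ rotate ∘ unitorˡ⁻¹ ≡⟨ refl⟩∘⟨ refl⟩∘⟨ trans (pullˡ (sym rotate-natural)) assoc ⟩
      ε ∘ (id ⊗₁ (r ∘ μ)) ∘ rotate ∘ (⌜e⌝ ⊗₁ (c-scale ⊗₁ t)) ∘ unitorˡ⁻¹ ≡⟨ trans (refl⟩∘⟨ sym assoc) (trans (sym assoc) (sym cyclic ⟩∘⟨refl)) ⟩
      (ε ∘ (μ ⊗₁ r) ∘ α⁻¹) ∘ (⌜e⌝ ⊗₁ (c-scale ⊗₁ t)) ∘ unitorˡ⁻¹ ≡⟨ trans assoc (refl⟩∘⟨ trans assoc (refl⟩∘⟨ trans (pullˡ α⁻¹-natural) assoc)) ⟩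
      ε ∘ (μ ⊗₁ r) ∘ ((⌜e⌝ ⊗₁ c-scale) ⊗₁ t) ∘ α⁻¹ ∘ unitorˡ⁻¹ ≡⟨ refl⟩∘⟨ pullˡ (sym ⊗-∘) ⟩
      ε ∘ ((μ ∘ (⌜e⌝ ⊗₁ c-scale)) ⊗₁ (r ∘ t)) ∘ α⁻¹ ∘ unitorˡ⁻¹ ≡⟨ refl⟩∘⟨ ((μ-⌜e⌝-c-scale ⟩⊗⟨ cancelˡ r-r⁻) ⟩∘⟨refl) ⟩
      ε ∘ ((c-scale ∘ unitorˡ) ⊗₁ s) ∘ α⁻¹ ∘ unitorˡ⁻¹ ≡⟨ refl⟩∘⟨ trans (split₁ʳ ⟩∘⟨refl) assoc ⟩
      ε ∘ (c-scale ⊗₁ s) ∘ (unitorˡ ⊗₁ id) ∘ α⁻¹ ∘ unitorˡ⁻¹ ≡⟨ refl⟩∘⟨ trans (refl⟩∘⟨ unitorˡ-coherence-cancel) identityʳ ⟩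
      ε ∘ (c-scale ⊗₁ s) ∎
      where
      merge-c-scale : (id ⊗₁ (r ∘ μ)) ∘ (c-scale ⊗₁ (t ⊗₁ ⌜e⌝)) ∘ (id ⊗₁ unitorʳ⁻¹) ≡ c-scale ⊗₁ (r ∘ μ ∘ (t ⊗₁ ⌜e⌝) ∘ unitorʳ⁻¹)
      merge-c-scale = begin
        (id ⊗₁ (r ∘ μ)) ∘ (c-scale ⊗₁ (t ⊗₁ ⌜e⌝)) ∘ (id ⊗₁ unitorʳ⁻¹) ≡⟨ pullˡ merge₂ ⟩
        (c-scale ⊗₁ ((r ∘ μ) ∘ (t ⊗₁ ⌜e⌝))) ∘ (id ⊗₁ unitorʳ⁻¹) ≡⟨ sym split₂ʳ ⟩
        c-scale ⊗₁ (((r ∘ μ) ∘ (t ⊗₁ ⌜e⌝)) ∘ unitorʳ⁻¹) ≡⟨ refl ⟩⊗⟨ trans assoc assoc ⟩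
        c-scale ⊗₁ (r ∘ μ ∘ (t ⊗₁ ⌜e⌝) ∘ unitorʳ⁻¹) ∎

    pairing-c-scale-s : ε ∘ (c-scale ⊗₁ s) ≡ ev {A} {I}
    pairing-c-scale-s = begin
      ε ∘ (c-scale ⊗₁ s) ≡⟨ refl⟩∘⟨ serialize₂₁ ⟩
      ε ∘ (id ⊗₁ s) ∘ (c-scale ⊗₁ id) ≡⟨ trans (pullˡ s-eq) assoc ⟩
      ev ∘ (at-p ⊗₁ id) ∘ (c-scale ⊗₁ id) ≡⟨ refl⟩∘⟨ sym split₁ˡ ⟩
      ev ∘ (at-p ∘ c-scale) ⊗₁ id ≡⟨ refl⟩∘⟨ (at-p-c-scale ⟩⊗⟨ refl) ⟩
      ev ∘ (id ⊗₁ id) ≡⟨ trans (refl⟩∘⟨ ⊗-id) identityʳ ⟩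
      ev ∎

    trace-mix : trace ∘ mixA ≡ ev ∘ σ
    trace-mix = begin
      trace ∘ mixA ≡⟨ refl⟩∘⟨ sym mix-factors ⟩
      (ε ∘ (id ⊗₁ (r ∘ ⌜v⌝)) ∘ unitorʳ⁻¹) ∘ μ ∘ (post-p ⊗₁ c-scale) ≡⟨ trans assoc (refl⟩∘⟨ trans assoc (refl⟩∘⟨ unitorʳ⁻¹-natural)) ⟩
      ε ∘ (id ⊗₁ (r ∘ ⌜v⌝)) ∘ ((μ ∘ (post-p ⊗₁ c-scale)) ⊗₁ id) ∘ unitorʳ⁻¹ ≡⟨ refl⟩∘⟨ pullˡ (sym serialize₂₁) ⟩
      ε ∘ ((μ ∘ (post-p ⊗₁ c-scale)) ⊗₁ (r ∘ ⌜v⌝)) ∘ unitorʳ⁻¹ ≡⟨ refl⟩∘⟨ (⊗-∘ ⟩∘⟨refl) ⟩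
      ε ∘ ((μ ⊗₁ r) ∘ ((post-p ⊗₁ c-scale) ⊗₁ ⌜v⌝)) ∘ unitorʳ⁻¹ ≡⟨ refl⟩∘⟨ trans assoc (refl⟩∘⟨ insertˡ α-isoˡ) ⟩
      ε ∘ (μ ⊗₁ r) ∘ α⁻¹ ∘ α ∘ ((post-p ⊗₁ c-scale) ⊗₁ ⌜v⌝) ∘ unitorʳ⁻¹ ≡⟨ refl⟩∘⟨ refl⟩∘⟨ refl⟩∘⟨ trans (pullˡ α-natural) assoc ⟩
      ε ∘ (μ ⊗₁ r) ∘ α⁻¹ ∘ (post-p ⊗₁ (c-scale ⊗₁ ⌜v⌝)) ∘ α ∘ unitorʳ⁻¹ ≡⟨ trans (refl⟩∘⟨ sym assoc) (trans (sym assoc) (cyclic ⟩∘⟨refl)) ⟩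
      (ε ∘ (id ⊗₁ (r ∘ μ)) ∘ rotate) ∘ (post-p ⊗₁ (c-scale ⊗₁ ⌜v⌝)) ∘ α ∘ unitorʳ⁻¹ ≡⟨ trans assoc (refl⟩∘⟨ trans assoc (refl⟩∘⟨ trans (pullˡ rotate-natural) assoc)) ⟩
      ε ∘ (id ⊗₁ (r ∘ μ)) ∘ (c-scale ⊗₁ (⌜v⌝ ⊗₁ post-p)) ∘ rotate ∘ α ∘ unitorʳ⁻¹ ≡⟨ refl⟩∘⟨ pullˡ merge₂ ⟩
      ε ∘ (c-scale ⊗₁ ((r ∘ μ) ∘ (⌜v⌝ ⊗₁ post-p))) ∘ rotate ∘ α ∘ unitorʳ⁻¹ ≡⟨ refl⟩∘⟨ ((refl ⟩⊗⟨ trans assoc (refl⟩∘⟨ μ-⌜v⌝-post-p)) ⟩∘⟨refl) ⟩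
      ε ∘ (c-scale ⊗₁ (r ∘ post-p ∘ δ ∘ unitorˡ)) ∘ rotate ∘ α ∘ unitorʳ⁻¹ ≡⟨ refl⟩∘⟨ (trans (refl ⟩⊗⟨ trans (refl⟩∘⟨ sym assoc) (sym assoc)) split₂ʳ ⟩∘⟨refl) ⟩
      ε ∘ ((c-scale ⊗₁ (r ∘ post-p ∘ δ)) ∘ (id ⊗₁ unitorˡ)) ∘ rotate ∘ α ∘ unitorʳ⁻¹ ≡⟨ refl⟩∘⟨ trans assoc (refl⟩∘⟨ rotate-unitor₃) ⟩
      ε ∘ (c-scale ⊗₁ (r ∘ post-p ∘ δ)) ∘ σ ≡⟨ refl⟩∘⟨ ((refl ⟩⊗⟨ refl⟩∘⟨ pullˡ post-p-post-c) ⟩∘⟨refl) ⟩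
      ε ∘ (c-scale ⊗₁ (r ∘ post-e ∘ t)) ∘ σ ≡⟨ trans (sym assoc) (trans (pairing-c-scale-post-e-t ⟩∘⟨refl) assoc) ⟩
      ε ∘ (c-scale ⊗₁ s) ∘ σ ≡⟨ pullˡ pairing-c-scale-s ⟩
      ev ∘ σ ∎

  module MixInverse {A : Obj} (p : I ⇒ A) (c : A ⇒ I) (cp : c ∘ p ≡ id) (jA : IsIso V (jmap V A))
                    (jD : IsIso V (jmap V ([ A , I ] ⊗₀ A)))
                    {B : Obj} {ε : ([ A , A ] ⊗₀ B) ⇒ I} {l r : [ A , A ] ⇒ B}
                    (fr : IsFrobenius V [ A , A ] B ε (icomp V A) l r) where
    open MonoidalReasoning
    open ClosedReasoning
    open PseudoAffineEndomorphisms p c cp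
    open FrobeniusTrace p c cp jA fr

    D* : Obj
    D* = [ D , I ]

    jD⁻ : [ D* , I ] ⇒ D
    jD⁻ = proj₁ jD

    jD-l : jD⁻ ∘ jmap V D ≡ id
    jD-l = proj₁ (proj₂ jD)

    jD-r : jmap V D ∘ jD⁻ ≡ id
    jD-r = proj₂ (proj₂ jD)

    apply-mix : (A ⊗₀ D) ⇒ A
    apply-mix = ev ∘ (id ⊗₁ mixA)

    Φ′ : (A* ⊗₀ (A ⊗₀ D)) ⇒ I
    Φ′ = ev ∘ σ ∘ (id ⊗₁ apply-mix)

    -- Φ ((ψ ⊗ x) ⊗ (φ ⊗ a)) = φ(x) ψ(a)
    Φ : (D ⊗₀ D) ⇒ I
    Φ = Φ′ ∘ α

    Ψ : D ⇒ D*
    Ψ = curry Φ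

    Λ : D* ⇒ M
    Λ = curry (jA⁻ ∘ curry (ev {D} {I} ∘ α⁻¹))

    trace-Λ : (D* ⊗₀ M) ⇒ I
    trace-Λ = trace ∘ μ ∘ σ ∘ (Λ ⊗₁ id)

    mix⁻¹ : M ⇒ D
    mix⁻¹ = jD⁻ ∘ curry trace-Λ

    Φ-trace : Φ ≡ trace ∘ μ ∘ (mixA ⊗₁ mixA)
    Φ-trace = sym (begin
      trace ∘ μ ∘ (mixA ⊗₁ mixA) ≡⟨ refl⟩∘⟨ refl⟩∘⟨ serialize₁₂ ⟩
      trace ∘ μ ∘ (mixA ⊗₁ id) ∘ (id ⊗₁ mixA) ≡⟨ refl⟩∘⟨ pullˡ μ-mixˡ ⟩
      trace ∘ (mixA ∘ (id ⊗₁ ev) ∘ α) ∘ (id ⊗₁ mixA) ≡⟨ refl⟩∘⟨ assoc ⟩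
      trace ∘ mixA ∘ ((id ⊗₁ ev) ∘ α) ∘ (id ⊗₁ mixA) ≡⟨ pullˡ trace-mix ⟩
      (ev ∘ σ) ∘ ((id ⊗₁ ev) ∘ α) ∘ (id ⊗₁ mixA) ≡⟨ trans assoc (refl⟩∘⟨ refl⟩∘⟨ ev-mix-α) ⟩
      ev ∘ σ ∘ (id ⊗₁ apply-mix) ∘ α ≡⟨ trans (refl⟩∘⟨ sym assoc) (sym assoc) ⟩
      (ev ∘ σ ∘ (id ⊗₁ apply-mix)) ∘ α ∎)
      where
      ev-mix-α : ((id ⊗₁ ev) ∘ α) ∘ (id ⊗₁ mixA) ≡ (id ⊗₁ apply-mix) ∘ α
      ev-mix-α = trans assoc (trans (refl⟩∘⟨ α-natural₃) (pullˡ (sym split₂ˡ)))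

    trace-μ-mix-precompose : trace ∘ μ ∘ (mixA ⊗₁ mixA) ≡ (ev ∘ σ) ∘ ((precompose ∘ (mixA ⊗₁ id)) ⊗₁ id) ∘ α⁻¹
    trace-μ-mix-precompose = begin
      trace ∘ μ ∘ (mixA ⊗₁ mixA) ≡⟨ refl⟩∘⟨ refl⟩∘⟨ serialize₂₁ ⟩
      trace ∘ μ ∘ (id ⊗₁ mixA) ∘ (mixA ⊗₁ id) ≡⟨ refl⟩∘⟨ pullˡ μ-mixʳ ⟩
      trace ∘ (mixA ∘ (precompose ⊗₁ id) ∘ α⁻¹) ∘ (mixA ⊗₁ id) ≡⟨ refl⟩∘⟨ assoc ⟩
      trace ∘ mixA ∘ ((precompose ⊗₁ id) ∘ α⁻¹) ∘ (mixA ⊗₁ id) ≡⟨ pullˡ trace-mix ⟩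
      (ev ∘ σ) ∘ ((precompose ⊗₁ id) ∘ α⁻¹) ∘ (mixA ⊗₁ id) ≡⟨ refl⟩∘⟨ precompose-mix-α⁻¹ ⟩
      (ev ∘ σ) ∘ ((precompose ∘ (mixA ⊗₁ id)) ⊗₁ id) ∘ α⁻¹ ∎
      where
      precompose-mix-α⁻¹ : ((precompose ⊗₁ id) ∘ α⁻¹) ∘ (mixA ⊗₁ id) ≡ ((precompose ∘ (mixA ⊗₁ id)) ⊗₁ id) ∘ α⁻¹
      precompose-mix-α⁻¹ = begin
        ((precompose ⊗₁ id) ∘ α⁻¹) ∘ (mixA ⊗₁ id) ≡⟨ trans assoc (refl⟩∘⟨ refl⟩∘⟨ (refl ⟩⊗⟨ sym ⊗-id)) ⟩
        (precompose ⊗₁ id) ∘ α⁻¹ ∘ (mixA ⊗₁ (id ⊗₁ id)) ≡⟨ refl⟩∘⟨ α⁻¹-natural ⟩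
        (precompose ⊗₁ id) ∘ ((mixA ⊗₁ id) ⊗₁ id) ∘ α⁻¹ ≡⟨ pullˡ (sym split₁ˡ) ⟩
        ((precompose ∘ (mixA ⊗₁ id)) ⊗₁ id) ∘ α⁻¹ ∎

    precompose-Φ-σ : (ev ∘ σ) ∘ ((precompose ∘ (mixA ⊗₁ id)) ⊗₁ id) ∘ α⁻¹ ≡ Φ ∘ σ
    precompose-Φ-σ = begin
      (ev ∘ σ) ∘ ((precompose ∘ (mixA ⊗₁ id)) ⊗₁ id) ∘ α⁻¹ ≡⟨ trans assoc (refl⟩∘⟨ trans (pullˡ σ-natural) assoc) ⟩
      ev ∘ (id ⊗₁ (precompose ∘ (mixA ⊗₁ id))) ∘ σ ∘ α⁻¹ ≡⟨ refl⟩∘⟨ trans (split₂ˡ ⟩∘⟨refl) assoc ⟩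
      ev ∘ (id ⊗₁ precompose) ∘ (id ⊗₁ (mixA ⊗₁ id)) ∘ σ ∘ α⁻¹ ≡⟨ trans (pullˡ ev-curry) (trans assoc (refl⟩∘⟨ assoc)) ⟩
      ev ∘ (ev ⊗₁ id) ∘ α⁻¹ ∘ (id ⊗₁ (mixA ⊗₁ id)) ∘ σ ∘ α⁻¹ ≡⟨ refl⟩∘⟨ refl⟩∘⟨ trans (pullˡ α⁻¹-natural) assoc ⟩
      ev ∘ (ev ⊗₁ id) ∘ ((id ⊗₁ mixA) ⊗₁ id) ∘ α⁻¹ ∘ σ ∘ α⁻¹ ≡⟨ refl⟩∘⟨ pullˡ (sym split₁ˡ) ⟩
      ev ∘ (apply-mix ⊗₁ id) ∘ α⁻¹ ∘ σ ∘ α⁻¹ ≡⟨ refl⟩∘⟨ refl⟩∘⟨ α⁻¹-σ-α⁻¹-rotated ⟩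
      ev ∘ (apply-mix ⊗₁ id) ∘ σ ∘ α ∘ σ ≡⟨ refl⟩∘⟨ pullˡ (sym σ-natural) ⟩
      ev ∘ (σ ∘ (id ⊗₁ apply-mix)) ∘ α ∘ σ ≡⟨ trans (refl⟩∘⟨ assoc) (sym (trans assoc (trans assoc (refl⟩∘⟨ assoc)))) ⟩
      ((ev ∘ σ ∘ (id ⊗₁ apply-mix)) ∘ α) ∘ σ ∎

    Φ-symmetric : Φ ∘ σ ≡ Φ
    Φ-symmetric = trans (sym precompose-Φ-σ) (trans (sym trace-μ-mix-precompose) (sym Φ-trace))

    Λ-Ψ : Λ ∘ Ψ ≡ mixA
    Λ-Ψ = uncurry-injective (begin
      ev ∘ (id ⊗₁ (Λ ∘ Ψ)) ≡⟨ trans (refl⟩∘⟨ split₂ˡ) (pullˡ ev-curry) ⟩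
      (jA⁻ ∘ curry (ev ∘ α⁻¹)) ∘ (id ⊗₁ Ψ) ≡⟨ trans assoc (refl⟩∘⟨ curry-natural) ⟩
      jA⁻ ∘ curry ((ev ∘ α⁻¹) ∘ (id ⊗₁ (id ⊗₁ Ψ))) ≡⟨ refl⟩∘⟨ cong curry Ψ-apply-mix ⟩
      jA⁻ ∘ curry ((ev ∘ σ) ∘ (id ⊗₁ apply-mix)) ≡⟨ refl⟩∘⟨ sym curry-natural ⟩
      jA⁻ ∘ jmap V A ∘ apply-mix ≡⟨ cancelˡ jA-l ⟩
      ev ∘ (id ⊗₁ mixA) ∎)
      where
      Ψ-apply-mix : (ev ∘ α⁻¹) ∘ (id ⊗₁ (id ⊗₁ Ψ)) ≡ (ev ∘ σ) ∘ (id ⊗₁ apply-mix)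
      Ψ-apply-mix = begin
        (ev ∘ α⁻¹) ∘ (id ⊗₁ (id ⊗₁ Ψ)) ≡⟨ trans assoc (refl⟩∘⟨ α⁻¹-natural₃) ⟩
        ev ∘ (id ⊗₁ Ψ) ∘ α⁻¹ ≡⟨ pullˡ ev-curry ⟩
        (Φ′ ∘ α) ∘ α⁻¹ ≡⟨ cancelʳ α-isoʳ ⟩
        ev ∘ σ ∘ (id ⊗₁ apply-mix) ≡⟨ sym assoc ⟩
        (ev ∘ σ) ∘ (id ⊗₁ apply-mix) ∎

    Φ′-via-Ψ : Φ′ ≡ ev ∘ (id ⊗₁ Ψ) ∘ σ ∘ α⁻¹
    Φ′-via-Ψ = sym (begin
      ev ∘ (id ⊗₁ Ψ) ∘ σ ∘ α⁻¹ ≡⟨ pullˡ ev-curry ⟩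
      Φ ∘ σ ∘ α⁻¹ ≡⟨ trans (sym assoc) (Φ-symmetric ⟩∘⟨refl) ⟩
      Φ ∘ α⁻¹ ≡⟨ cancelʳ α-isoʳ ⟩
      Φ′ ∎)

    ev-α⁻¹ : (A* ⊗₀ (A ⊗₀ D*)) ⇒ I
    ev-α⁻¹ = ev {D} {I} ∘ α⁻¹

    ev-σ-Λ : ev ∘ σ ∘ (id ⊗₁ ev) ∘ α ∘ (id ⊗₁ Λ) ≡ ev {D} {I}
    ev-σ-Λ = begin
      ev ∘ σ ∘ (id ⊗₁ ev) ∘ α ∘ (id ⊗₁ Λ) ≡⟨ refl⟩∘⟨ refl⟩∘⟨ refl⟩∘⟨ α-natural₃ ⟩
      ev ∘ σ ∘ (id ⊗₁ ev) ∘ (id ⊗₁ (id ⊗₁ Λ)) ∘ α ≡⟨ refl⟩∘⟨ refl⟩∘⟨ pullˡ (sym split₂ˡ) ⟩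
      ev ∘ σ ∘ (id ⊗₁ (ev ∘ (id ⊗₁ Λ))) ∘ α ≡⟨ refl⟩∘⟨ refl⟩∘⟨ ((refl ⟩⊗⟨ ev-curry) ⟩∘⟨refl) ⟩
      ev ∘ σ ∘ (id ⊗₁ (jA⁻ ∘ curry ev-α⁻¹)) ∘ α ≡⟨ refl⟩∘⟨ trans (pullˡ σ-natural) assoc ⟩
      ev ∘ ((jA⁻ ∘ curry ev-α⁻¹) ⊗₁ id) ∘ σ ∘ α ≡⟨ refl⟩∘⟨ trans (split₁ˡ ⟩∘⟨refl) assoc ⟩
      ev ∘ (jA⁻ ⊗₁ id) ∘ (curry ev-α⁻¹ ⊗₁ id) ∘ σ ∘ α ≡⟨ trans (pullˡ (ev-j⁻¹ jA⁻ jA-r)) assoc ⟩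
      ev ∘ σ ∘ (curry ev-α⁻¹ ⊗₁ id) ∘ σ ∘ α ≡⟨ refl⟩∘⟨ trans (pullˡ σ-natural) assoc ⟩
      ev ∘ (id ⊗₁ curry ev-α⁻¹) ∘ σ ∘ σ ∘ α ≡⟨ refl⟩∘⟨ refl⟩∘⟨ cancelˡ σ-involutive ⟩
      ev ∘ (id ⊗₁ curry ev-α⁻¹) ∘ α ≡⟨ pullˡ ev-curry ⟩
      (ev ∘ α⁻¹) ∘ α ≡⟨ cancelʳ α-isoˡ ⟩
      ev ∎

    trace-Λ-mix : trace-Λ ∘ (id ⊗₁ mixA) ≡ ev ∘ σ
    trace-Λ-mix = begin
      (trace ∘ μ ∘ σ ∘ (Λ ⊗₁ id)) ∘ (id ⊗₁ mixA) ≡⟨ trans assoc (refl⟩∘⟨ trans assoc (refl⟩∘⟨ trans assoc (refl⟩∘⟨ sym serialize₁₂))) ⟩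
      trace ∘ μ ∘ σ ∘ (Λ ⊗₁ mixA) ≡⟨ refl⟩∘⟨ refl⟩∘⟨ σ-natural ⟩
      trace ∘ μ ∘ (mixA ⊗₁ Λ) ∘ σ ≡⟨ refl⟩∘⟨ refl⟩∘⟨ trans (serialize₁₂ ⟩∘⟨refl) assoc ⟩
      trace ∘ μ ∘ (mixA ⊗₁ id) ∘ (id ⊗₁ Λ) ∘ σ ≡⟨ refl⟩∘⟨ pullˡ μ-mixˡ ⟩
      trace ∘ (mixA ∘ (id ⊗₁ ev) ∘ α) ∘ (id ⊗₁ Λ) ∘ σ ≡⟨ trans (refl⟩∘⟨ assoc) (pullˡ trace-mix) ⟩
      (ev ∘ σ) ∘ ((id ⊗₁ ev) ∘ α) ∘ (id ⊗₁ Λ) ∘ σ ≡⟨ trans (trans assoc (refl⟩∘⟨ refl⟩∘⟨ assoc)) (sym (trans assoc (refl⟩∘⟨ trans assoc (refl⟩∘⟨ trans assoc (refl⟩∘⟨ assoc))))) ⟩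
      (ev ∘ σ ∘ (id ⊗₁ ev) ∘ α ∘ (id ⊗₁ Λ)) ∘ σ ≡⟨ ev-σ-Λ ⟩∘⟨refl ⟩
      ev ∘ σ ∎

    trace-Λ-Ψ : trace-Λ ∘ (Ψ ⊗₁ id) ∘ α⁻¹ ≡ ev ∘ σ ∘ (id ⊗₁ ev)
    trace-Λ-Ψ = begin
      (trace ∘ μ ∘ σ ∘ (Λ ⊗₁ id)) ∘ (Ψ ⊗₁ id) ∘ α⁻¹ ≡⟨ trans assoc (refl⟩∘⟨ trans assoc (refl⟩∘⟨ trans assoc (refl⟩∘⟨ pullˡ (sym split₁ˡ)))) ⟩
      trace ∘ μ ∘ σ ∘ ((Λ ∘ Ψ) ⊗₁ id) ∘ α⁻¹ ≡⟨ refl⟩∘⟨ refl⟩∘⟨ refl⟩∘⟨ ((Λ-Ψ ⟩⊗⟨ refl) ⟩∘⟨refl) ⟩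
      trace ∘ μ ∘ σ ∘ (mixA ⊗₁ id) ∘ α⁻¹ ≡⟨ refl⟩∘⟨ refl⟩∘⟨ trans (pullˡ σ-natural) assoc ⟩
      trace ∘ μ ∘ (id ⊗₁ mixA) ∘ σ ∘ α⁻¹ ≡⟨ refl⟩∘⟨ pullˡ μ-mixʳ ⟩
      trace ∘ (mixA ∘ (precompose ⊗₁ id) ∘ α⁻¹) ∘ σ ∘ α⁻¹ ≡⟨ trans (refl⟩∘⟨ assoc) (pullˡ trace-mix) ⟩
      (ev ∘ σ) ∘ ((precompose ⊗₁ id) ∘ α⁻¹) ∘ σ ∘ α⁻¹ ≡⟨ trans assoc (refl⟩∘⟨ refl⟩∘⟨ assoc) ⟩
      ev ∘ σ ∘ (precompose ⊗₁ id) ∘ α⁻¹ ∘ σ ∘ α⁻¹ ≡⟨ refl⟩∘⟨ trans (pullˡ σ-natural) assoc ⟩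
      ev ∘ (id ⊗₁ precompose) ∘ σ ∘ α⁻¹ ∘ σ ∘ α⁻¹ ≡⟨ trans (pullˡ ev-curry) (trans assoc (refl⟩∘⟨ assoc)) ⟩
      ev ∘ (ev ⊗₁ id) ∘ α⁻¹ ∘ σ ∘ α⁻¹ ∘ σ ∘ α⁻¹ ≡⟨ refl⟩∘⟨ refl⟩∘⟨ sym σ-rotations ⟩
      ev ∘ (ev ⊗₁ id) ∘ σ ≡⟨ refl⟩∘⟨ sym σ-natural ⟩
      ev ∘ σ ∘ (id ⊗₁ ev) ∎

    Φ′-mix⁻¹ : Φ′ ∘ (id ⊗₁ (id ⊗₁ mix⁻¹)) ≡ trace-Λ ∘ (Ψ ⊗₁ id) ∘ α⁻¹
    Φ′-mix⁻¹ = begin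
      Φ′ ∘ (id ⊗₁ (id ⊗₁ mix⁻¹)) ≡⟨ Φ′-via-Ψ ⟩∘⟨refl ⟩
      (ev ∘ (id ⊗₁ Ψ) ∘ σ ∘ α⁻¹) ∘ (id ⊗₁ (id ⊗₁ mix⁻¹)) ≡⟨ trans assoc (refl⟩∘⟨ trans assoc (refl⟩∘⟨ trans assoc (refl⟩∘⟨ α⁻¹-natural₃))) ⟩
      ev ∘ (id ⊗₁ Ψ) ∘ σ ∘ (id ⊗₁ mix⁻¹) ∘ α⁻¹ ≡⟨ refl⟩∘⟨ refl⟩∘⟨ trans (pullˡ σ-natural) assoc ⟩
      ev ∘ (id ⊗₁ Ψ) ∘ (mix⁻¹ ⊗₁ id) ∘ σ ∘ α⁻¹ ≡⟨ refl⟩∘⟨ pullˡ (sym serialize₂₁) ⟩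
      ev ∘ (mix⁻¹ ⊗₁ Ψ) ∘ σ ∘ α⁻¹ ≡⟨ refl⟩∘⟨ trans (trans (refl ⟩⊗⟨ sym identityˡ) ⊗-∘ ⟩∘⟨refl) assoc ⟩
      ev ∘ (jD⁻ ⊗₁ id) ∘ (curry trace-Λ ⊗₁ Ψ) ∘ σ ∘ α⁻¹ ≡⟨ trans (pullˡ (ev-j⁻¹ jD⁻ jD-r)) assoc ⟩
      ev ∘ σ ∘ (curry trace-Λ ⊗₁ Ψ) ∘ σ ∘ α⁻¹ ≡⟨ refl⟩∘⟨ trans (pullˡ σ-natural) assoc ⟩
      ev ∘ (Ψ ⊗₁ curry trace-Λ) ∘ σ ∘ σ ∘ α⁻¹ ≡⟨ refl⟩∘⟨ refl⟩∘⟨ cancelˡ σ-involutive ⟩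
      ev ∘ (Ψ ⊗₁ curry trace-Λ) ∘ α⁻¹ ≡⟨ refl⟩∘⟨ trans (serialize₂₁ ⟩∘⟨refl) assoc ⟩
      ev ∘ (id ⊗₁ curry trace-Λ) ∘ (Ψ ⊗₁ id) ∘ α⁻¹ ≡⟨ pullˡ ev-curry ⟩
      trace-Λ ∘ (Ψ ⊗₁ id) ∘ α⁻¹ ∎

    mix⁻¹-mix : mix⁻¹ ∘ mixA ≡ id
    mix⁻¹-mix = begin
      (jD⁻ ∘ curry trace-Λ) ∘ mixA ≡⟨ trans assoc (refl⟩∘⟨ curry-natural) ⟩
      jD⁻ ∘ curry (trace-Λ ∘ (id ⊗₁ mixA)) ≡⟨ refl⟩∘⟨ cong curry trace-Λ-mix ⟩
      jD⁻ ∘ jmap V D ≡⟨ jD-l ⟩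
      id ∎

    mix-mix⁻¹ : mixA ∘ mix⁻¹ ≡ id
    mix-mix⁻¹ = uncurry-injective (split-mono-cancel jA-l (trans curry-natural (trans (cong curry jA-transposes) (sym curry-natural))))
      where
      jA-transposes : (ev ∘ σ) ∘ (id ⊗₁ (ev ∘ (id ⊗₁ (mixA ∘ mix⁻¹)))) ≡ (ev ∘ σ) ∘ (id ⊗₁ (ev ∘ (id ⊗₁ id)))
      jA-transposes = begin
        (ev ∘ σ) ∘ (id ⊗₁ (ev ∘ (id ⊗₁ (mixA ∘ mix⁻¹)))) ≡⟨ refl⟩∘⟨ (refl ⟩⊗⟨ trans (refl⟩∘⟨ split₂ˡ) (sym assoc)) ⟩
        (ev ∘ σ) ∘ (id ⊗₁ (apply-mix ∘ (id ⊗₁ mix⁻¹))) ≡⟨ trans (refl⟩∘⟨ split₂ˡ) (trans assoc (refl⟩∘⟨ sym assoc)) ⟩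
        ev ∘ (σ ∘ (id ⊗₁ apply-mix)) ∘ (id ⊗₁ (id ⊗₁ mix⁻¹)) ≡⟨ sym assoc ⟩
        Φ′ ∘ (id ⊗₁ (id ⊗₁ mix⁻¹)) ≡⟨ Φ′-mix⁻¹ ⟩
        trace-Λ ∘ (Ψ ⊗₁ id) ∘ α⁻¹ ≡⟨ trace-Λ-Ψ ⟩
        ev ∘ σ ∘ (id ⊗₁ ev) ≡⟨ sym assoc ⟩
        (ev ∘ σ) ∘ (id ⊗₁ ev) ≡⟨ refl⟩∘⟨ (refl ⟩⊗⟨ sym (trans (refl⟩∘⟨ ⊗-id) identityʳ)) ⟩
        (ev ∘ σ) ∘ (id ⊗₁ (ev ∘ (id ⊗₁ id))) ∎

mainTheorem4 : {o ℓ : Level} (V : SMCC o ℓ) → StarAutonomous V →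
    (A : SMCC.Obj V) → PseudoAffine V A →
    HasFrobenius V (SMCC.[_,_] V A A) (icomp V A) →
    Nuclear V A
mainTheorem4 V sa A (p , c , cp) (_ , _ , _ , _ , fr) =
  mix⁻¹ , mix⁻¹-mix , mix-mix⁻¹
  where open MixInverse V p c cp (sa A) (sa _) fr
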